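{- Let $P$ be a stacked $d$-polytope whose stack subdivision contains exactly $k$ $d$-simplices. Then $$\Phi(P)=k\cdot\Phi(\Delta_d)-(k-1)\cdot\Phi(\Delta_{d-1})\cdot c,$$ where $\Delta_j$ denotes the face poset of the $j$-simplex.
   Context: $\Phi(Q)$ denotes the cd-index of the face lattice of a polytope $Q$ (including the empty face and $Q$ itself): for an Eulerian poset $L$ of rank $m+1$, with $\alpha_L(S)$ the number of maximal chains among elements with rank in $S\subseteq[m]$, $\beta_L(S)=\sum_{T\subseteq S}(-1)^{|S\setminus T|}\alpha_L(T)$ and $\Psi_L=\sum_S\beta_L(S)u_S$ ($u_S$ the word in noncommuting $a,b$ with $b$ in positions of $S$, $a$ elsewhere), $\Phi_L$ is the unique noncommutative polynomial with $\Phi_L(a+b,ab+ba)=\Psi_L$; products are noncommutative. A triangulation of a simplicial polytope is a subdivision into simplices whose boundary complex is combinatorially isomorphic to the polytope's boundary. A simplicial $d$-polytope $P$ is stacked if it has a triangulation $\Gamma$ (its stack subdivision) in which every face of dimension $\le d-2$ is a face of $P$; equivalently $P$ arises from a $d$-simplex by repeatedly placing a point beyond a facet and taking the convex hull, i.e. by gluing $d$-simplices one at a time, each meeting the previous complex in exactly one facet. -}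

module Defs where

open import Data.Bool using (Bool; true; false; if_then_else_; _∧_; not)
open import Data.Nat using (ℕ; zero; suc; _≡ᵇ_; _∸_; _+_)
open import Data.Integer using (ℤ; +_; _*_; -_) renaming (_+_ to _+ℤ_)
open import Data.List using (List; []; _∷_; [_]; _++_; map; concatMap; foldr; length)
open import Data.Bool.ListAction using (any)
open import Data.Nat.ListAction using (sum)
open import Data.List.Membership.Propositional using (_∈_)
open import Data.List.Relation.Unary.Any using (_─_)
open import Data.Product using (_×_; _,_)
open import Data.Sum using (_⊎_; inj₁; inj₂)
open import Data.Unit using (⊤; tt)
open import Data.Fin using (Fin)
open import Data.Vec using (_∷_; toList; allFin)
open import Data.Fin.Subset using (Subset; inside; outside; ∁; ⁅_⁆; _-_; ∣_∣)
open import Data.Fin.Subset.Properties using (_⊆?_)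
open import Relation.Nullary using (does)
open import Relation.Binary.PropositionalEquality using (_≡_)

-- Noncommutative polynomials with integer coefficients in letters X:
-- finite formal sums of (coefficient , word).  Two polynomials are equal
-- (_≈ₚ_) when all their word-coefficients agree.

Poly : Set → Set
Poly X = List (ℤ × List X)

wordEq : {X : Set} → (X → X → Bool) → List X → List X → Bool
wordEq eq []       []       = true
wordEq eq (x ∷ xs) (y ∷ ys) = eq x y ∧ wordEq eq xs ys
wordEq eq _        _        = false

coeff : {X : Set} → (X → X → Bool) → Poly X → List X → ℤ
coeff eq []             w = + 0
coeff eq ((z , u) ∷ p)  w = (if wordEq eq u w then z else + 0) +ℤ coeff eq p w

_⊕_ : {X : Set} → Poly X → Poly X → Poly X
p ⊕ q = p ++ q

_⊛_ : {X : Set} → ℤ → Poly X → Poly X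
z ⊛ p = map (λ { (y , u) → (z * y , u) }) p

_⊗_ : {X : Set} → Poly X → Poly X → Poly X
p ⊗ q = concatMap (λ { (y , u) → map (λ { (z , v) → (y * z , u ++ v) }) q }) p

onePoly : {X : Set} → Poly X
onePoly = [ (+ 1 , []) ]

-- letters a, b  (a = false, b = true)
AB : Set
AB = Bool

eqAB : AB → AB → Bool
eqAB true  true  = true
eqAB false false = true
eqAB _     _     = false

_≈ab_ : Poly AB → Poly AB → Set
p ≈ab q = ∀ w → coeff eqAB p w ≡ coeff eqAB q w

data CD : Set where
  cL dL : CD

cPoly : Poly CD
cPoly = [ (+ 1 , cL ∷ []) ]

-- substitution c ↦ a+b , d ↦ ab+ba
substLetter : CD → Poly AB
substLetter cL = (+ 1 , false ∷ []) ∷ (+ 1 , true ∷ []) ∷ []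
substLetter dL = (+ 1 , false ∷ true ∷ []) ∷ (+ 1 , true ∷ false ∷ []) ∷ []

substWord : List CD → Poly AB
substWord []       = onePoly
substWord (x ∷ xs) = substLetter x ⊗ substWord xs

substCD : Poly CD → Poly AB
substCD p = concatMap (λ { (z , u) → z ⊛ substWord u }) p

record FinGradedPoset : Set₁ where
  field
    Elt   : Set
    elems : List Elt          -- all elements, each exactly once
    leq   : Elt → Elt → Bool
    rank  : Elt → ℕ
    m     : ℕ                 -- the poset has rank m+1

open FinGradedPoset public

-- words of length n over {a,b}; such a word u_S encodes S ⊆ [n]
-- (b = true in the positions of S)
allWords : ℕ → List (List Bool)
allWords zero    = [ [] ]
allWords (suc n) = map (false ∷_) (allWords n) ++ map (true ∷_) (allWords n)

filterᵇ' : {A : Set} → (A → Bool) → List A → List A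
filterᵇ' f []       = []
filterᵇ' f (x ∷ xs) = if f x then x ∷ filterᵇ' f xs else filterᵇ' f xs

-- number of chains x_1 < ... < x_j whose ranks are exactly the positions
-- r, r+1, ... marked true in the word, all above `prev`
chainCount : (L : FinGradedPoset) → (prev : Elt L ⊎ ⊤) → ℕ → List Bool → ℕ
chainCount L prev r []          = 1
chainCount L prev r (false ∷ w) = chainCount L prev (suc r) w
chainCount L prev r (true ∷ w)  =
  sum (map (λ y → chainCount L (inj₁ y) (suc r) w)
           (filterᵇ' (λ y → (rank L y ≡ᵇ r) ∧ above y prev) (elems L)))
  where
  above : Elt L → Elt L ⊎ ⊤ → Bool
  above y (inj₁ x) = leq L x y
  above y (inj₂ _) = true

-- α_L(S): number of maximal chains of the rank-selected subposet L_S
α : (L : FinGradedPoset) → List Bool → ℕ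
α L S = chainCount L (inj₂ tt) 1 S

subWordᵇ : List Bool → List Bool → Bool
subWordᵇ []       []       = true
subWordᵇ (t ∷ T) (s ∷ S)  = (not t Data.Bool.∨ s) ∧ subWordᵇ T S
subWordᵇ _        _        = false

countTrue : List Bool → ℕ
countTrue []          = 0
countTrue (true ∷ w)  = suc (countTrue w)
countTrue (false ∷ w) = countTrue w

sign : ℕ → ℤ
sign zero          = + 1
sign (suc zero)    = - (+ 1)
sign (suc (suc n)) = sign n

sumℤ : List ℤ → ℤ
sumℤ = foldr _+ℤ_ (+ 0)

β : (L : FinGradedPoset) → List Bool → ℤ
β L S = sumℤ (map (λ T → if subWordᵇ T S
                            then sign (countTrue S ∸ countTrue T) * + (α L T)
                            else + 0)
                  (allWords (m L)))

Ψ : FinGradedPoset → Poly AB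
Ψ L = map (λ S → (β L S , S)) (allWords (m L))

IsCDIndex : FinGradedPoset → Poly CD → Set
IsCDIndex L Φ = substCD Φ ≈ab Ψ L

allSubsets : (n : ℕ) → List (Subset n)
allSubsets zero    = [ Data.Vec.[] ]
allSubsets (suc n) = map (outside ∷_) (allSubsets n) ++ map (inside ∷_) (allSubsets n)

simplexLattice : ℕ → FinGradedPoset
simplexLattice j = record
  { Elt   = Subset (suc j)
  ; elems = allSubsets (suc j)
  ; leq   = λ S T → does (S ⊆? T)
  ; rank  = ∣_∣
  ; m     = j
  }

-- Stacked d k n Fs : a stacked d-polytope built from k d-simplices, on
-- the vertex set Fin n, whose boundary facets are the list Fs.  Step: place a new vertex
-- beyond a boundary facet F (glue the simplex F ∪ {new}); F leaves the
-- boundary and the d facets (F ∖ {v}) ∪ {new}, v ∈ F, are added.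

simplexFacets : (d : ℕ) → List (Subset (suc d))
simplexFacets d = map (λ i → ∁ ⁅ i ⁆) (toList (allFin (suc d)))

newFacets : {n : ℕ} → Subset n → List (Subset (suc n))
newFacets {n} F = map (λ v → inside ∷ (F - v))
                      (filterᵇ' (λ v → Data.Vec.lookup F v) (toList (allFin n)))

data Stacked (d : ℕ) : ℕ → (n : ℕ) → List (Subset n) → Set where
  base  : Stacked d 1 (suc d) (simplexFacets d)
  stack : ∀ {k n Fs F} → Stacked d k n Fs → (F∈Fs : F ∈ Fs) →
          Stacked d (suc k) (suc n)
                  (newFacets F ++ map (outside ∷_) (Fs ─ F∈Fs))

-- Face lattice of the d-polytope with boundary facets Fs on vertices Fin n:
-- all faces of the boundary complex (including ∅), plus the polytope
-- itself as top element of rank d+1.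
boundaryFaces : {n : ℕ} → List (Subset n) → List (Subset n)
boundaryFaces {n} Fs = filterᵇ' (λ S → any (λ F → does (S ⊆? F)) Fs) (allSubsets n)

polytopeLattice : (d n : ℕ) → List (Subset n) → FinGradedPoset
polytopeLattice d n Fs = record
  { Elt   = Subset n ⊎ ⊤
  ; elems = map inj₁ (boundaryFaces Fs) ++ (inj₂ tt ∷ [])
  ; leq   = le
  ; rank  = rk
  ; m     = d
  }
  where
  le : Subset n ⊎ ⊤ → Subset n ⊎ ⊤ → Bool
  le (inj₁ S) (inj₁ T) = does (S ⊆? T)
  le _        (inj₂ _) = true
  le (inj₂ _) (inj₁ _) = false
  rk : Subset n ⊎ ⊤ → ℕ
  rk (inj₁ S) = ∣ S ∣
  rk (inj₂ _) = suc d

-- Flag numbers of a simplicial polytope only see its boundary complex K, a down-closed family of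
-- vertex sets: if t is the largest rank in S, then α(S) = f_t(K) · α_{B_t}(S), because the faces
-- below a face with t vertices form a Boolean lattice B_t. Gluing a simplex onto a facet F of a
-- stacked d-polytope adds the faces G ∪ {v_new}, G ⊊ F, and loses F itself, so a polytope built
-- from k simplices has f_t = k·C(d+1,t) − (k−1)·(C(d,t) + [t = d]). The second term is the face
-- count of Δ_{d−1} with the letter c appended, hence α(P) = k·α(Δ_d) − (k−1)·α(Δ_{d−1}·c) for every
-- rank set. The flag h-vector β is a linear (Möbius) transform of α, and substituting c = a + b
-- turns appending c into appending either letter, which gives the cd-index identity.

module Submission where

open import Defs

open import Data.Bool using (Bool; true; false; if_then_else_; _∧_; _∨_; not; T)
open import Data.Bool.Properties using (T-≡; ∧-zeroʳ; ∧-identityʳ; ∨-identityʳ; ∨-assoc; ∨-comm; ∧-assoc; ∧-comm)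
open import Data.Bool.ListAction using (any; or)
open import Data.Empty using (⊥-elim)
open import Data.Fin using (Fin) renaming (zero to fzero; suc to fsuc)
open import Data.Fin.Subset using (Subset; inside; outside; ∣_∣; ⊥; ⊤; _-_; ∁; ⁅_⁆)
open import Data.Fin.Subset.Properties using (_⊆?_; ∣⊥∣≡0; ∣⊤∣≡n; ∣p∣≤n; p─⊥≡p)
open import Data.Integer using (ℤ) renaming (_+_ to _+ℤ_; _*_ to _*ℤ_; _-_ to _-ℤ_; -_ to -ℤ_)
import Data.Integer.Properties as ℤ
open import Data.Integer.Tactic.RingSolver using () renaming (solve-∀ to ℤ-solve-∀)
open import Data.List using (List; []; _∷_; [_]; _++_; map; length; _∷ʳ_; initLast; _∷ʳ′_)
open import Data.List.Properties using (map-++; map-∘; map-cong; ++-assoc; concatMap-++)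
open import Data.List.Membership.Propositional using (_∈_)
open import Data.List.Membership.Propositional.Properties using (∈-map⁻; ∈-++⁻)
open import Data.List.Relation.Unary.All using (All; []; _∷_)
open import Data.List.Relation.Unary.All.Properties using (∷ʳ⁺)
open import Data.List.Relation.Unary.Any using (here; there; _─_)
open import Data.Nat using (ℕ; zero; suc; _+_; _*_; _∸_; _≤_; _<_; z≤n; s≤s; _≡ᵇ_)
open import Data.Nat.Combinatorics using (_C_; nCk+nC[k+1]≡[n+1]C[k+1]; nCn≡1)
open import Data.Nat.ListAction using (sum)
open import Data.Nat.ListAction.Properties using (sum-++)
open import Data.Nat.Properties
open import Algebra.Properties.CommutativeSemigroup +-commutativeSemigroup using (interchange; x∙yz≈y∙xz; xy∙z≈xz∙y)
open import Data.Nat.Tactic.RingSolver using (solve-∀)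
open import Data.Product using (_×_; _,_; proj₁; proj₂; ∃-syntax)
open import Data.Sum using (_⊎_; inj₁; inj₂)
open import Data.Unit using (tt)
open import Data.Vec using (lookup; toList; allFin; tabulate) renaming ([] to []ᵥ; _∷_ to _∷ᵥ_)
open import Function using (_∘_; Equivalence)
open import Relation.Nullary using (does)
open import Relation.Binary.PropositionalEquality hiding ([_])

𝟙 : Bool → ℕ
𝟙 true  = 1
𝟙 false = 0

true⇒T : ∀ {b} → b ≡ true → T b
true⇒T = Equivalence.from T-≡

T⇒true : ∀ {b} → T b → b ≡ true
T⇒true = Equivalence.to T-≡

≢⇒≡ᵇ≡false : ∀ m n → m ≢ n → (m ≡ᵇ n) ≡ false
≢⇒≡ᵇ≡false m n m≢n with m ≡ᵇ n in eq
... | false = refl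
... | true  = ⊥-elim (m≢n (≡ᵇ⇒≡ m n (true⇒T eq)))

∨-absorbˡ : ∀ x y → (y ≡ true → x ≡ true) → x ∨ y ≡ x
∨-absorbˡ true  y _   = refl
∨-absorbˡ false y y⇒x with y
... | false = refl
... | true  = sym (y⇒x refl)

𝟙-*-cong : ∀ b {x y} → (b ≡ true → x ≡ y) → 𝟙 b * x ≡ 𝟙 b * y
𝟙-*-cong true  x≡y = cong (1 *_) (x≡y refl)
𝟙-*-cong false _   = refl

if-𝟙 : ∀ b x → (if b then x else 0) ≡ 𝟙 b * x
if-𝟙 true  x = sym (+-identityʳ x)
if-𝟙 false x = refl

if-if-𝟙 : ∀ a b x → (if a then (if b then x else 0) else 0) ≡ 𝟙 (a ∧ b) * x
if-if-𝟙 true  b x = if-𝟙 b x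
if-if-𝟙 false b x = refl

if-𝟙-∧ : ∀ b x → (if b then 𝟙 x else 0) ≡ 𝟙 (b ∧ x)
if-𝟙-∧ true  x = refl
if-𝟙-∧ false x = refl

𝟙+≡1 : ∀ b c → 1 ≤ c → 𝟙 b + c ≡ 1 → b ≡ false × c ≡ 1
𝟙+≡1 true  (suc c) _ ()
𝟙+≡1 false c       _ c≡1 = refl , c≡1

𝟙-∨-disjoint : ∀ x y c → (x ∧ y) ≡ false → 𝟙 (x ∧ c) + 𝟙 (y ∧ c) ≡ 𝟙 ((x ∨ y) ∧ c)
𝟙-∨-disjoint true  false c _ = +-identityʳ _
𝟙-∨-disjoint false y     c _ = refl

∑ : {A : Set} → List A → (A → ℕ) → ℕ
∑ xs f = sum (map f xs)

infix 6.2 ∑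
syntax ∑ xs (λ x → e) = ∑[ x ← xs ] e

module _ {A : Set} where

  ∑-++ : ∀ (xs ys : List A) f → ∑ (xs ++ ys) f ≡ ∑ xs f + ∑ ys f
  ∑-++ xs ys f = trans (cong sum (map-++ f xs ys)) (sum-++ (map f xs) (map f ys))

  ∑-cong : ∀ (xs : List A) {f g : A → ℕ} → (∀ x → f x ≡ g x) → ∑ xs f ≡ ∑ xs g
  ∑-cong xs f≗g = cong sum (map-cong f≗g xs)

  ∑-zero : ∀ (xs : List A) → ∑[ _ ← xs ] 0 ≡ 0
  ∑-zero []       = refl
  ∑-zero (_ ∷ xs) = ∑-zero xs

  ∑-+ : ∀ (xs : List A) f g → ∑[ x ← xs ] (f x + g x) ≡ ∑ xs f + ∑ xs g
  ∑-+ []       f g = refl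
  ∑-+ (x ∷ xs) f g = trans (cong ((f x + g x) +_) (∑-+ xs f g)) (interchange (f x) (g x) _ _)

  ∑-*ˡ : ∀ (xs : List A) c f → ∑[ x ← xs ] (c * f x) ≡ c * ∑ xs f
  ∑-*ˡ []       c f = sym (*-zeroʳ c)
  ∑-*ˡ (x ∷ xs) c f = trans (cong (c * f x +_) (∑-*ˡ xs c f)) (sym (*-distribˡ-+ c (f x) _))

  ∑-*ʳ : ∀ (xs : List A) c f → ∑[ x ← xs ] (f x * c) ≡ ∑ xs f * c
  ∑-*ʳ xs c f = trans (∑-cong xs (λ x → *-comm (f x) c)) (trans (∑-*ˡ xs c f) (*-comm c _))

  ∑-filter : ∀ (p : A → Bool) f xs → ∑ (filterᵇ' p xs) f ≡ ∑[ x ← xs ] (if p x then f x else 0)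
  ∑-filter p f []       = refl
  ∑-filter p f (x ∷ xs) with p x
  ... | true  = cong (f x +_) (∑-filter p f xs)
  ... | false = ∑-filter p f xs

∑-map : ∀ {A B : Set} (g : A → B) xs (f : B → ℕ) → ∑ (map g xs) f ≡ ∑ xs (f ∘ g)
∑-map g xs f = cong sum (sym (map-∘ xs))

∑-swap : ∀ {A B : Set} (xs : List A) (ys : List B) (f : A → B → ℕ) →
         ∑[ x ← xs ] ∑[ y ← ys ] f x y ≡ ∑[ y ← ys ] ∑[ x ← xs ] f x y
∑-swap []       ys f = sym (∑-zero ys)
∑-swap (x ∷ xs) ys f =
  trans (cong (∑ ys (f x) +_) (∑-swap xs ys f)) (sym (∑-+ ys (f x) (λ y → ∑[ x′ ← xs ] f x′ y)))

module _ {A : Set} where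

  any-map : ∀ (p : A → Bool) {B : Set} (g : B → A) xs → any p (map g xs) ≡ any (p ∘ g) xs
  any-map p g xs = cong or (sym (map-∘ xs))

  any-++ : ∀ (p : A → Bool) xs ys → any p (xs ++ ys) ≡ any p xs ∨ any p ys
  any-++ p []       ys = refl
  any-++ p (x ∷ xs) ys = trans (cong (p x ∨_) (any-++ p xs ys)) (sym (∨-assoc (p x) _ _))

  any-filter : ∀ (p h : A → Bool) xs → any p (filterᵇ' h xs) ≡ any (λ x → h x ∧ p x) xs
  any-filter p h []       = refl
  any-filter p h (x ∷ xs) with h x
  ... | true  = cong (p x ∨_) (any-filter p h xs)
  ... | false = any-filter p h xs

  any-false : ∀ (xs : List A) → any (λ _ → false) xs ≡ false
  any-false []       = refl
  any-false (_ ∷ xs) = any-false xs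

  ∈-filter⁻ : ∀ (h : A → Bool) {x} xs → x ∈ filterᵇ' h xs → h x ≡ true
  ∈-filter⁻ h (y ∷ xs) x∈ with h y in hy
  ∈-filter⁻ h (y ∷ xs) (here refl) | true  = hy
  ∈-filter⁻ h (y ∷ xs) (there x∈)  | true  = ∈-filter⁻ h xs x∈
  ∈-filter⁻ h (y ∷ xs) x∈          | false = ∈-filter⁻ h xs x∈

  ∈-─⁻ : ∀ {x y : A} {xs} (x∈ : x ∈ xs) → y ∈ (xs ─ x∈) → y ∈ xs
  ∈-─⁻ (here refl) y∈          = there y∈
  ∈-─⁻ (there x∈)  (here refl) = here refl
  ∈-─⁻ (there x∈)  (there y∈)  = there (∈-─⁻ x∈ y∈)

  ∑-─ : ∀ (f : A → ℕ) {x xs} (x∈ : x ∈ xs) → ∑ xs f ≡ f x + ∑ (xs ─ x∈) f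
  ∑-─ f (here refl)                = refl
  ∑-─ f {x} {y ∷ xs} (there x∈) =
    trans (cong (f y +_) (∑-─ f x∈)) (x∙yz≈y∙xz (f y) (f x) _)

  any-─ : ∀ (p : A → Bool) {x xs} (x∈ : x ∈ xs) → any p xs ≡ p x ∨ any p (xs ─ x∈)
  any-─ p (here refl)                = refl
  any-─ p {x} {y ∷ xs} (there x∈) =
    trans (cong (p y ∨_) (any-─ p x∈)) (trans (sym (∨-assoc (p y) (p x) _))
          (trans (cong (_∨ any p (xs ─ x∈)) (∨-comm (p y) (p x))) (∨-assoc (p x) (p y) _)))

  ∑-≥ : ∀ (f : A → ℕ) {x xs} → x ∈ xs → f x ≤ ∑ xs f
  ∑-≥ f (here refl)              = m≤m+n _ _
  ∑-≥ f {xs = y ∷ xs} (there x∈) = ≤-trans (∑-≥ f x∈) (m≤n+m _ (f y))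

  ∑-𝟙≡0 : ∀ (p : A → Bool) xs → ∑[ x ← xs ] 𝟙 (p x) ≡ 0 → any p xs ≡ false
  ∑-𝟙≡0 p []       _ = refl
  ∑-𝟙≡0 p (x ∷ xs) s with p x
  ... | false = ∑-𝟙≡0 p xs s

length-∷ʳ : ∀ {A : Set} (w : List A) x → length (w ∷ʳ x) ≡ suc (length w)
length-∷ʳ []      x = refl
length-∷ʳ (_ ∷ w) x = cong suc (length-∷ʳ w x)

anyᶠ : ∀ {n} → (Fin n → Bool) → Bool
anyᶠ {zero}  f = false
anyᶠ {suc n} f = f fzero ∨ anyᶠ (f ∘ fsuc)

sumᶠ : ∀ {n} → (Fin n → ℕ) → ℕ
sumᶠ {zero}  f = 0
sumᶠ {suc n} f = f fzero + sumᶠ (f ∘ fsuc)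

anyᶠ-cong : ∀ {n} {f g : Fin n → Bool} → (∀ i → f i ≡ g i) → anyᶠ f ≡ anyᶠ g
anyᶠ-cong {zero}  f≗g = refl
anyᶠ-cong {suc n} f≗g = cong₂ _∨_ (f≗g fzero) (anyᶠ-cong (f≗g ∘ fsuc))

anyᶠ-false : ∀ {n} {f : Fin n → Bool} → (∀ i → f i ≡ false) → anyᶠ f ≡ false
anyᶠ-false {zero}  _    = refl
anyᶠ-false {suc n} none = cong₂ _∨_ (none fzero) (anyᶠ-false (none ∘ fsuc))

sumᶠ-cong : ∀ {n} {f g : Fin n → ℕ} → (∀ i → f i ≡ g i) → sumᶠ f ≡ sumᶠ g
sumᶠ-cong {zero}  f≗g = refl
sumᶠ-cong {suc n} f≗g = cong₂ _+_ (f≗g fzero) (sumᶠ-cong (f≗g ∘ fsuc))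

sumᶠ-zero : ∀ {n} {f : Fin n → ℕ} → (∀ i → f i ≡ 0) → sumᶠ f ≡ 0
sumᶠ-zero {zero}  _    = refl
sumᶠ-zero {suc n} none = cong₂ _+_ (none fzero) (sumᶠ-zero (none ∘ fsuc))

any-tabulate : ∀ {A : Set} {n} (p : A → Bool) (g : Fin n → A) → any p (toList (tabulate g)) ≡ anyᶠ (p ∘ g)
any-tabulate {n = zero}  p g = refl
any-tabulate {n = suc n} p g = cong (p (g fzero) ∨_) (any-tabulate p (g ∘ fsuc))

∑-tabulate : ∀ {A : Set} {n} (g : Fin n → A) f → ∑ (toList (tabulate g)) f ≡ sumᶠ (f ∘ g)
∑-tabulate {n = zero}  g f = refl
∑-tabulate {n = suc n} g f = cong (f (g fzero) +_) (∑-tabulate (g ∘ fsuc) f)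

infix 7 _⊆ᵇ_

_⊆ᵇ_ : ∀ {n} → Subset n → Subset n → Bool
[]ᵥ            ⊆ᵇ []ᵥ            = true
(outside ∷ᵥ p) ⊆ᵇ (_ ∷ᵥ q)       = p ⊆ᵇ q
(inside ∷ᵥ p)  ⊆ᵇ (outside ∷ᵥ q) = false
(inside ∷ᵥ p)  ⊆ᵇ (inside ∷ᵥ q)  = p ⊆ᵇ q

does-⊆? : ∀ {n} (p q : Subset n) → does (p ⊆? q) ≡ (p ⊆ᵇ q)
does-⊆? []ᵥ            []ᵥ            = refl
does-⊆? (outside ∷ᵥ p) (_ ∷ᵥ q)       = does-⊆? p q
does-⊆? (inside ∷ᵥ p)  (outside ∷ᵥ q) = refl
does-⊆? (inside ∷ᵥ p)  (inside ∷ᵥ q)  = does-⊆? p q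

⊆ᵇ-refl : ∀ {n} (p : Subset n) → (p ⊆ᵇ p) ≡ true
⊆ᵇ-refl []ᵥ            = refl
⊆ᵇ-refl (outside ∷ᵥ p) = ⊆ᵇ-refl p
⊆ᵇ-refl (inside ∷ᵥ p)  = ⊆ᵇ-refl p

⊆ᵇ-trans : ∀ {n} (p q r : Subset n) → (p ⊆ᵇ q) ≡ true → (q ⊆ᵇ r) ≡ true → (p ⊆ᵇ r) ≡ true
⊆ᵇ-trans []ᵥ            []ᵥ            []ᵥ            _   _   = refl
⊆ᵇ-trans (outside ∷ᵥ p) (outside ∷ᵥ q) (_ ∷ᵥ r)       p⊆q q⊆r = ⊆ᵇ-trans p q r p⊆q q⊆r
⊆ᵇ-trans (outside ∷ᵥ p) (inside ∷ᵥ q)  (inside ∷ᵥ r)  p⊆q q⊆r = ⊆ᵇ-trans p q r p⊆q q⊆r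
⊆ᵇ-trans (inside ∷ᵥ p)  (inside ∷ᵥ q)  (inside ∷ᵥ r)  p⊆q q⊆r = ⊆ᵇ-trans p q r p⊆q q⊆r

⊥⊆ᵇ : ∀ {n} (p : Subset n) → (⊥ ⊆ᵇ p) ≡ true
⊥⊆ᵇ []ᵥ      = refl
⊥⊆ᵇ (_ ∷ᵥ p) = ⊥⊆ᵇ p

⊆ᵇ⊤ : ∀ {n} (p : Subset n) → (p ⊆ᵇ ⊤) ≡ true
⊆ᵇ⊤ []ᵥ            = refl
⊆ᵇ⊤ (outside ∷ᵥ p) = ⊆ᵇ⊤ p
⊆ᵇ⊤ (inside ∷ᵥ p)  = ⊆ᵇ⊤ p

⊆ᵇ⇒∣∣≤ : ∀ {n} (p q : Subset n) → (p ⊆ᵇ q) ≡ true → ∣ p ∣ ≤ ∣ q ∣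
⊆ᵇ⇒∣∣≤ []ᵥ            []ᵥ            _   = z≤n
⊆ᵇ⇒∣∣≤ (outside ∷ᵥ p) (outside ∷ᵥ q) p⊆q = ⊆ᵇ⇒∣∣≤ p q p⊆q
⊆ᵇ⇒∣∣≤ (outside ∷ᵥ p) (inside ∷ᵥ q)  p⊆q = m≤n⇒m≤1+n (⊆ᵇ⇒∣∣≤ p q p⊆q)
⊆ᵇ⇒∣∣≤ (inside ∷ᵥ p)  (inside ∷ᵥ q)  p⊆q = s≤s (⊆ᵇ⇒∣∣≤ p q p⊆q)

∑-allSubsets : ∀ {n} (f : Subset (suc n) → ℕ) →
               ∑ (allSubsets (suc n)) f ≡
               ∑[ S ← allSubsets n ] f (outside ∷ᵥ S) + ∑[ S ← allSubsets n ] f (inside ∷ᵥ S)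
∑-allSubsets {n} f =
  trans (∑-++ (map (outside ∷ᵥ_) (allSubsets n)) _ f)
        (cong₂ _+_ (∑-map _ (allSubsets n) f) (∑-map _ (allSubsets n) f))

inIntervalLayer : ∀ {n} → Subset n → Subset n → ℕ → Subset n → ℕ
inIntervalLayer y G k S = 𝟙 (S ⊆ᵇ G ∧ (y ⊆ᵇ S ∧ (∣ S ∣ ≡ᵇ ∣ y ∣ + k)))

intervalLayer : ∀ {n} → Subset n → Subset n → ℕ → ℕ
intervalLayer {n} y G k = ∑ (allSubsets n) (inIntervalLayer y G k)

intervalLayer≡C : ∀ {n} (y G : Subset n) m k → (y ⊆ᵇ G) ≡ true → ∣ G ∣ ≡ ∣ y ∣ + m →
                  intervalLayer y G k ≡ m C k
intervalLayer≡C []ᵥ []ᵥ zero zero    _ _ = refl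
intervalLayer≡C []ᵥ []ᵥ zero (suc k) _ _ = refl
intervalLayer≡C {suc n} (outside ∷ᵥ y) (outside ∷ᵥ G) m k y⊆G ∣G∣ =
  trans (∑-allSubsets (inIntervalLayer (outside ∷ᵥ y) (outside ∷ᵥ G) k))
        (trans (cong₂ _+_ (intervalLayer≡C y G m k y⊆G ∣G∣) (∑-zero (allSubsets n))) (+-identityʳ _))
intervalLayer≡C (outside ∷ᵥ y) (inside ∷ᵥ G) zero k y⊆G ∣G∣ =
  ⊥-elim (<⇒≱ (s≤s (⊆ᵇ⇒∣∣≤ y G y⊆G)) (≤-reflexive (trans ∣G∣ (+-identityʳ _))))
intervalLayer≡C {suc n} (outside ∷ᵥ y) (inside ∷ᵥ G) (suc m) zero y⊆G ∣G∣ =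
  trans (∑-allSubsets (inIntervalLayer (outside ∷ᵥ y) (inside ∷ᵥ G) zero))
        (cong₂ _+_ (intervalLayer≡C y G m zero y⊆G ∣G∣′) (trans (∑-cong (allSubsets n) none) (∑-zero (allSubsets n))))
  where
  ∣G∣′ = suc-injective (trans ∣G∣ (+-suc _ m))
  none : ∀ S → 𝟙 (S ⊆ᵇ G ∧ (y ⊆ᵇ S ∧ (suc ∣ S ∣ ≡ᵇ ∣ y ∣ + 0))) ≡ 0
  none S with y ⊆ᵇ S in y⊆S
  ... | false = cong 𝟙 (∧-zeroʳ _)
  ... | true with suc ∣ S ∣ ≡ᵇ ∣ y ∣ + 0 in eq
  ...   | false = cong 𝟙 (∧-zeroʳ _)
  ...   | true  = ⊥-elim (<⇒≱ (s≤s (⊆ᵇ⇒∣∣≤ y S y⊆S))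
                              (≤-reflexive (trans (≡ᵇ⇒≡ _ _ (true⇒T eq)) (+-identityʳ _))))
intervalLayer≡C {suc n} (outside ∷ᵥ y) (inside ∷ᵥ G) (suc m) (suc k) y⊆G ∣G∣ =
  begin
    intervalLayer (outside ∷ᵥ y) (inside ∷ᵥ G) (suc k)
  ≡⟨ ∑-allSubsets (inIntervalLayer (outside ∷ᵥ y) (inside ∷ᵥ G) (suc k)) ⟩
    intervalLayer y G (suc k) + ∑[ S ← allSubsets n ] 𝟙 (S ⊆ᵇ G ∧ (y ⊆ᵇ S ∧ (suc ∣ S ∣ ≡ᵇ ∣ y ∣ + suc k)))
  ≡⟨ cong (intervalLayer y G (suc k) +_)
          (∑-cong (allSubsets n) (λ S → cong (λ j → 𝟙 (S ⊆ᵇ G ∧ (y ⊆ᵇ S ∧ (suc ∣ S ∣ ≡ᵇ j)))) (+-suc ∣ y ∣ k))) ⟩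
    intervalLayer y G (suc k) + intervalLayer y G k
  ≡⟨ cong₂ _+_ (intervalLayer≡C y G m (suc k) y⊆G ∣G∣′) (intervalLayer≡C y G m k y⊆G ∣G∣′) ⟩
    m C suc k + m C k
  ≡⟨ trans (+-comm (m C suc k) (m C k)) (nCk+nC[k+1]≡[n+1]C[k+1] m k) ⟩
    suc m C suc k
  ∎
  where
  open ≡-Reasoning
  ∣G∣′ = suc-injective (trans ∣G∣ (+-suc _ m))
intervalLayer≡C {suc n} (inside ∷ᵥ y) (inside ∷ᵥ G) m k y⊆G ∣G∣ =
  trans (∑-allSubsets (inIntervalLayer (inside ∷ᵥ y) (inside ∷ᵥ G) k))
        (cong₂ _+_ (trans (∑-cong (allSubsets n) (λ S → cong 𝟙 (∧-zeroʳ (S ⊆ᵇ G)))) (∑-zero (allSubsets n)))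
                   (intervalLayer≡C y G m k y⊆G (suc-injective ∣G∣)))

subsetsOfSize : ∀ {n} → Subset n → ℕ → ℕ
subsetsOfSize {n} F t = ∑[ G ← allSubsets n ] 𝟙 (G ⊆ᵇ F ∧ (∣ G ∣ ≡ᵇ t))

subsetsOfSize≡C : ∀ {n} (F : Subset n) t → subsetsOfSize F t ≡ ∣ F ∣ C t
subsetsOfSize≡C {n} F t =
  trans (∑-cong (allSubsets n) (λ G → cong₂ (λ b s → 𝟙 (G ⊆ᵇ F ∧ (b ∧ (∣ G ∣ ≡ᵇ s))))
                                            (sym (⊥⊆ᵇ G)) (cong (_+ t) (sym (∣⊥∣≡0 n)))))
        (intervalLayer≡C ⊥ F ∣ F ∣ t (⊥⊆ᵇ F) (cong (_+ ∣ F ∣) (sym (∣⊥∣≡0 n))))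

infix 7 _==_ _⊂ᵇ_

_==_ : ∀ {n} → Subset n → Subset n → Bool
[]ᵥ            == []ᵥ            = true
(outside ∷ᵥ p) == (outside ∷ᵥ q) = p == q
(inside ∷ᵥ p)  == (inside ∷ᵥ q)  = p == q
(outside ∷ᵥ p) == (inside ∷ᵥ q)  = false
(inside ∷ᵥ p)  == (outside ∷ᵥ q) = false

==⇒≡ : ∀ {n} (p q : Subset n) → (p == q) ≡ true → p ≡ q
==⇒≡ []ᵥ            []ᵥ            _  = refl
==⇒≡ (outside ∷ᵥ p) (outside ∷ᵥ q) eq = cong (outside ∷ᵥ_) (==⇒≡ p q eq)
==⇒≡ (inside ∷ᵥ p)  (inside ∷ᵥ q)  eq = cong (inside ∷ᵥ_) (==⇒≡ p q eq)

∑-== : ∀ {n} (F : Subset n) (q : Subset n → Bool) → ∑[ G ← allSubsets n ] 𝟙 (G == F ∧ q G) ≡ 𝟙 (q F)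
∑-== []ᵥ q = +-identityʳ _
∑-== {suc n} (outside ∷ᵥ F) q =
  trans (∑-allSubsets (λ G → 𝟙 (G == (outside ∷ᵥ F) ∧ q G)))
        (trans (cong₂ _+_ (∑-== F (q ∘ (outside ∷ᵥ_))) (∑-zero (allSubsets n))) (+-identityʳ _))
∑-== {suc n} (inside ∷ᵥ F) q =
  trans (∑-allSubsets (λ G → 𝟙 (G == (inside ∷ᵥ F) ∧ q G)))
        (cong₂ _+_ (∑-zero (allSubsets n)) (∑-== F (q ∘ (inside ∷ᵥ_))))

lookup-⊤ : ∀ {n} (v : Fin n) → lookup ⊤ v ≡ true
lookup-⊤ fzero    = refl
lookup-⊤ (fsuc v) = lookup-⊤ v

∁⊥≡⊤ : ∀ {n} → ∁ (⊥ {n}) ≡ ⊤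
∁⊥≡⊤ {zero}  = refl
∁⊥≡⊤ {suc n} = cong (inside ∷ᵥ_) ∁⊥≡⊤

∁⁅i⁆≡⊤-i : ∀ {n} (i : Fin n) → ∁ ⁅ i ⁆ ≡ ⊤ - i
∁⁅i⁆≡⊤-i fzero    = cong (outside ∷ᵥ_) (trans ∁⊥≡⊤ (sym (p─⊥≡p ⊤)))
∁⁅i⁆≡⊤-i (fsuc i) = cong (inside ∷ᵥ_) (∁⁅i⁆≡⊤-i i)

p-x⊆ᵇp : ∀ {n} (p : Subset n) x → ((p - x) ⊆ᵇ p) ≡ true
p-x⊆ᵇp (_ ∷ᵥ p)       fzero    = trans (cong (_⊆ᵇ p) (p─⊥≡p p)) (⊆ᵇ-refl p)
p-x⊆ᵇp (outside ∷ᵥ p) (fsuc x) = p-x⊆ᵇp p x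
p-x⊆ᵇp (inside ∷ᵥ p)  (fsuc x) = p-x⊆ᵇp p x

p⊈ᵇp-x : ∀ {n} (p : Subset n) x → lookup p x ≡ true → (p ⊆ᵇ (p - x)) ≡ false
p⊈ᵇp-x (inside ∷ᵥ p)  fzero    _   = refl
p⊈ᵇp-x (outside ∷ᵥ p) (fsuc x) x∈p = p⊈ᵇp-x p x x∈p
p⊈ᵇp-x (inside ∷ᵥ p)  (fsuc x) x∈p = p⊈ᵇp-x p x x∈p

suc∣p-x∣≡∣p∣ : ∀ {n} (p : Subset n) x → lookup p x ≡ true → suc ∣ p - x ∣ ≡ ∣ p ∣
suc∣p-x∣≡∣p∣ (inside ∷ᵥ p)  fzero    _   = cong (suc ∘ ∣_∣) (p─⊥≡p p)
suc∣p-x∣≡∣p∣ (outside ∷ᵥ p) (fsuc x) x∈p = suc∣p-x∣≡∣p∣ p x x∈p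
suc∣p-x∣≡∣p∣ (inside ∷ᵥ p)  (fsuc x) x∈p = cong suc (suc∣p-x∣≡∣p∣ p x x∈p)

facets-containing-p-x≡1 : ∀ {n} (p : Subset n) x → lookup p x ≡ true →
                          sumᶠ (λ y → 𝟙 (lookup p y ∧ (p - x) ⊆ᵇ (p - y))) ≡ 1
facets-containing-p-x≡1 (inside ∷ᵥ p) fzero _ =
  cong₂ _+_ (cong 𝟙 (trans (cong (λ q → q ⊆ᵇ q) (p─⊥≡p p)) (⊆ᵇ-refl p)))
            (sumᶠ-zero (λ y → trans (cong (λ q → 𝟙 (lookup p y ∧ q ⊆ᵇ (p - y))) (p─⊥≡p p)) (other y)))
  where
  other : ∀ y → 𝟙 (lookup p y ∧ p ⊆ᵇ (p - y)) ≡ 0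
  other y with lookup p y in y∈p
  ... | false = refl
  ... | true  = cong 𝟙 (p⊈ᵇp-x p y y∈p)
facets-containing-p-x≡1 (outside ∷ᵥ p) (fsuc x) x∈p = facets-containing-p-x≡1 p x x∈p
facets-containing-p-x≡1 (inside ∷ᵥ p)  (fsuc x) x∈p = facets-containing-p-x≡1 p x x∈p

_⊂ᵇ_ : ∀ {n} → Subset n → Subset n → Bool
G ⊂ᵇ F = anyᶠ (λ v → lookup F v ∧ G ⊆ᵇ (F - v))

⊂ᵇ-∷ : ∀ {n} a b (G F : Subset n) →
       (a ∷ᵥ G) ⊂ᵇ (b ∷ᵥ F) ≡ (b ∧ (a ∷ᵥ G) ⊆ᵇ (outside ∷ᵥ F)) ∨ anyᶠ (λ v → lookup F v ∧ (a ∷ᵥ G) ⊆ᵇ (b ∷ᵥ (F - v)))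
⊂ᵇ-∷ a b G F =
  cong (λ q → (b ∧ (a ∷ᵥ G) ⊆ᵇ (outside ∷ᵥ q)) ∨ anyᶠ (λ v → lookup F v ∧ (a ∷ᵥ G) ⊆ᵇ (b ∷ᵥ (F - v)))) (p─⊥≡p F)

⊆ᵇ≡⊂ᵇ∨== : ∀ {n} (G F : Subset n) → G ⊆ᵇ F ≡ G ⊂ᵇ F ∨ G == F
⊆ᵇ≡⊂ᵇ∨== []ᵥ            []ᵥ            = refl
⊆ᵇ≡⊂ᵇ∨== (outside ∷ᵥ G) (outside ∷ᵥ F) =
  trans (⊆ᵇ≡⊂ᵇ∨== G F) (cong (_∨ G == F) (sym (⊂ᵇ-∷ outside outside G F)))
⊆ᵇ≡⊂ᵇ∨== (inside ∷ᵥ G)  (inside ∷ᵥ F)  =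
  trans (⊆ᵇ≡⊂ᵇ∨== G F) (cong (_∨ G == F) (sym (⊂ᵇ-∷ inside inside G F)))
⊆ᵇ≡⊂ᵇ∨== (outside ∷ᵥ G) (inside ∷ᵥ F)  =
  sym (trans (cong (_∨ false) (⊂ᵇ-∷ outside inside G F))
      (trans (∨-identityʳ _) (∨-absorbˡ (G ⊆ᵇ F) (G ⊂ᵇ F) (λ G⊂F →
        trans (⊆ᵇ≡⊂ᵇ∨== G F) (cong (_∨ G == F) G⊂F)))))
⊆ᵇ≡⊂ᵇ∨== (inside ∷ᵥ G)  (outside ∷ᵥ F) =
  sym (trans (cong (_∨ false) (⊂ᵇ-∷ inside outside G F))
      (trans (∨-identityʳ _) (anyᶠ-false (λ v → ∧-zeroʳ (lookup F v)))))

⊂ᵇ-irrefl : ∀ {n} (F : Subset n) → F ⊂ᵇ F ≡ false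
⊂ᵇ-irrefl F = anyᶠ-false not-in-facet
  where
  not-in-facet : ∀ v → (lookup F v ∧ F ⊆ᵇ (F - v)) ≡ false
  not-in-facet v with lookup F v in v∈F
  ... | false = refl
  ... | true  = p⊈ᵇp-x F v v∈F

properSubsetsOfSize≡C : ∀ {n} (F : Subset n) t → t ≢ ∣ F ∣ →
                        ∑[ G ← allSubsets n ] 𝟙 (G ⊂ᵇ F ∧ (∣ G ∣ ≡ᵇ t)) ≡ ∣ F ∣ C t
properSubsetsOfSize≡C {n} F t t≢∣F∣ =
  trans (∑-cong (allSubsets n) (cong 𝟙 ∘ proper⇔sub)) (subsetsOfSize≡C F t)
  where
  proper⇔sub : ∀ G → (G ⊂ᵇ F ∧ (∣ G ∣ ≡ᵇ t)) ≡ (G ⊆ᵇ F ∧ (∣ G ∣ ≡ᵇ t))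
  proper⇔sub G with G == F in G=F
  ... | true rewrite ==⇒≡ G F G=F | ≢⇒≡ᵇ≡false ∣ F ∣ t (t≢∣F∣ ∘ sym) =
    trans (∧-zeroʳ _) (sym (∧-zeroʳ _))
  ... | false =
    cong (_∧ (∣ G ∣ ≡ᵇ t)) (sym (trans (⊆ᵇ≡⊂ᵇ∨== G F) (trans (cong (G ⊂ᵇ F ∨_) G=F) (∨-identityʳ _))))

-- Chains in down-closed families of sets

𝟙-layers-exchange : ∀ KS KG a b yS SG yG →
                    (KG ≡ true → SG ≡ true → KS ≡ true) → (yS ≡ true → SG ≡ true → yG ≡ true) →
                    𝟙 (KS ∧ (a ∧ yS)) * 𝟙 (KG ∧ (b ∧ SG)) ≡ 𝟙 (KG ∧ (b ∧ yG)) * 𝟙 (SG ∧ (yS ∧ a))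
𝟙-layers-exchange KS    false a     b     yS    SG    yG    _  _  = *-zeroʳ (𝟙 (KS ∧ (a ∧ yS)))
𝟙-layers-exchange KS    true  a     false yS    SG    yG    _  _  = *-zeroʳ (𝟙 (KS ∧ (a ∧ yS)))
𝟙-layers-exchange KS    true  a     true  yS    false yG    _  _  =
  trans (*-zeroʳ (𝟙 (KS ∧ (a ∧ yS)))) (sym (*-zeroʳ (𝟙 yG)))
𝟙-layers-exchange false true  a     true  yS    true  yG    K⇒ _  with () ← K⇒ refl refl
𝟙-layers-exchange true  true  a     true  false true  yG    _  _  =
  trans (cong (λ x → 𝟙 x * 1) (∧-zeroʳ a)) (sym (*-zeroʳ (𝟙 yG)))
𝟙-layers-exchange true  true  a     true  true  true  false _  y⇒ with () ← y⇒ refl refl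
𝟙-layers-exchange true  true  false true  true  true  true  _  _  = refl
𝟙-layers-exchange true  true  true  true  true  true  true  _  _  = refl

DownClosed : ∀ {n} → (Subset n → Bool) → Set
DownClosed K = ∀ S G → K G ≡ true → (S ⊆ᵇ G) ≡ true → K S ≡ true

-- The number of chains from a fixed s-set to a fixed t-set through sets of the sizes
-- (counted from r) marked true in w.
booleanFlags : ℕ → ℕ → ℕ → List Bool → ℕ
booleanFlags t s r []          = 1
booleanFlags t s r (false ∷ w) = booleanFlags t s (suc r) w
booleanFlags t s r (true ∷ w)  = ((t ∸ s) C (r ∸ s)) * booleanFlags t r (suc r) w

booleanFlags-allFalse : ∀ t s r {w} → All (_≡ false) w → booleanFlags t s r w ≡ 1
booleanFlags-allFalse t s r []           = refl
booleanFlags-allFalse t s r (refl ∷ all) = booleanFlags-allFalse t s (suc r) all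

booleanFlags-∷ʳfalse : ∀ t s r w → booleanFlags t s r (w ∷ʳ false) ≡ booleanFlags t s r w
booleanFlags-∷ʳfalse t s r []          = refl
booleanFlags-∷ʳfalse t s r (false ∷ w) = booleanFlags-∷ʳfalse t s (suc r) w
booleanFlags-∷ʳfalse t s r (true ∷ w)  = cong (((t ∸ s) C (r ∸ s)) *_) (booleanFlags-∷ʳfalse t r (suc r) w)

data LastTrue : ℕ → List Bool → ℕ → Set where
  here  : ∀ {r w} → All (_≡ false) w → LastTrue r (true ∷ w) r
  there : ∀ {r b w t} → LastTrue (suc r) w t → LastTrue r (b ∷ w) t

LastTrue⇒≤ : ∀ {r w t} → LastTrue r w t → r ≤ t
LastTrue⇒≤ (here _)  = ≤-refl
LastTrue⇒≤ (there l) = ≤-trans (n≤1+n _) (LastTrue⇒≤ l)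

lastTrue? : ∀ r w → All (_≡ false) w ⊎ ∃[ t ] LastTrue r w t
lastTrue? r []          = inj₁ []
lastTrue? r (false ∷ w) with lastTrue? (suc r) w
... | inj₁ all     = inj₁ (refl ∷ all)
... | inj₂ (t , l) = inj₂ (t , there l)
lastTrue? r (true ∷ w)  with lastTrue? (suc r) w
... | inj₁ all     = inj₂ (r , here all)
... | inj₂ (t , l) = inj₂ (t , there l)

LastTrue⇒< : ∀ {r w t} → LastTrue r w t → t < r + length w
LastTrue⇒< {r} {true ∷ w} (here _)    = subst (r <_) (sym (+-suc r (length w))) (s≤s (m≤m+n r (length w)))
LastTrue⇒< {r} {_ ∷ w} {t} (there l) = subst (t <_) (sym (+-suc r (length w))) (LastTrue⇒< l)

LastTrue-∷ʳfalse : ∀ {r w t} → LastTrue r w t → LastTrue r (w ∷ʳ false) t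
LastTrue-∷ʳfalse (here all) = here (∷ʳ⁺ all refl)
LastTrue-∷ʳfalse (there l)  = there (LastTrue-∷ʳfalse l)

LastTrue-∷ʳtrue : ∀ r w → LastTrue r (w ∷ʳ true) (r + length w)
LastTrue-∷ʳtrue r []      = subst (LastTrue r (true ∷ [])) (sym (+-identityʳ r)) (here [])
LastTrue-∷ʳtrue r (_ ∷ w) = subst (LastTrue r _) (sym (+-suc r (length w))) (there (LastTrue-∷ʳtrue (suc r) w))

module _ {n : ℕ} (K : Subset n → Bool) where

  inLayerAbove : Subset n → ℕ → Subset n → ℕ
  inLayerAbove y r S = 𝟙 (K S ∧ ((∣ S ∣ ≡ᵇ r) ∧ y ⊆ᵇ S))

  chains : Subset n → ℕ → List Bool → ℕ
  chains y r []          = 1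
  chains y r (false ∷ w) = chains y (suc r) w
  chains y r (true ∷ w)  = ∑[ S ← allSubsets n ] inLayerAbove y r S * chains S (suc r) w

  facesAbove : Subset n → ℕ → ℕ
  facesAbove y t = ∑ (allSubsets n) (inLayerAbove y t)

  chains-allFalse : ∀ y r {w} → All (_≡ false) w → chains y r w ≡ 1
  chains-allFalse y r []           = refl
  chains-allFalse y r (refl ∷ all) = chains-allFalse y (suc r) all

  ∑-facesAbove : DownClosed K → ∀ y r t → ∣ y ∣ ≤ r → r ≤ t →
                 ∑[ S ← allSubsets n ] inLayerAbove y r S * facesAbove S t ≡
                 facesAbove y t * ((t ∸ ∣ y ∣) C (r ∸ ∣ y ∣))
  ∑-facesAbove down y r t ∣y∣≤r r≤t =
    begin
      ∑[ S ← Ss ] inLayerAbove y r S * facesAbove S t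
    ≡⟨ ∑-cong Ss (λ S → sym (∑-*ˡ Ss (inLayerAbove y r S) (inLayerAbove S t))) ⟩
      ∑[ S ← Ss ] ∑[ G ← Ss ] inLayerAbove y r S * inLayerAbove S t G
    ≡⟨ ∑-swap Ss Ss (λ S G → inLayerAbove y r S * inLayerAbove S t G) ⟩
      ∑[ G ← Ss ] ∑[ S ← Ss ] inLayerAbove y r S * inLayerAbove S t G
    ≡⟨ ∑-cong Ss (λ G → ∑-cong Ss (λ S →
         𝟙-layers-exchange (K S) (K G) _ _ (y ⊆ᵇ S) (S ⊆ᵇ G) (y ⊆ᵇ G) (down S G) (⊆ᵇ-trans y S G))) ⟩
      ∑[ G ← Ss ] ∑[ S ← Ss ] inLayerAbove y t G * 𝟙 (S ⊆ᵇ G ∧ (y ⊆ᵇ S ∧ (∣ S ∣ ≡ᵇ r)))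
    ≡⟨ ∑-cong Ss (λ G → ∑-*ˡ Ss (inLayerAbove y t G) _) ⟩
      ∑[ G ← Ss ] inLayerAbove y t G * (∑[ S ← Ss ] 𝟙 (S ⊆ᵇ G ∧ (y ⊆ᵇ S ∧ (∣ S ∣ ≡ᵇ r))))
    ≡⟨ ∑-cong Ss (λ G → 𝟙-*-cong (K G ∧ ((∣ G ∣ ≡ᵇ t) ∧ y ⊆ᵇ G)) (layer G)) ⟩
      ∑[ G ← Ss ] inLayerAbove y t G * ((t ∸ ∣ y ∣) C (r ∸ ∣ y ∣))
    ≡⟨ ∑-*ʳ Ss ((t ∸ ∣ y ∣) C (r ∸ ∣ y ∣)) (inLayerAbove y t) ⟩
      facesAbove y t * ((t ∸ ∣ y ∣) C (r ∸ ∣ y ∣))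
    ∎
    where
    open ≡-Reasoning
    Ss = allSubsets n
    layer : ∀ G → (K G ∧ ((∣ G ∣ ≡ᵇ t) ∧ y ⊆ᵇ G)) ≡ true →
            ∑[ S ← Ss ] 𝟙 (S ⊆ᵇ G ∧ (y ⊆ᵇ S ∧ (∣ S ∣ ≡ᵇ r))) ≡ (t ∸ ∣ y ∣) C (r ∸ ∣ y ∣)
    layer G G-above with K G | ∣ G ∣ ≡ᵇ t in ∣G∣≡t | y ⊆ᵇ G in y⊆G
    ... | true | true | true =
      trans (∑-cong Ss (λ S → cong (λ j → 𝟙 (S ⊆ᵇ G ∧ (y ⊆ᵇ S ∧ (∣ S ∣ ≡ᵇ j)))) (sym (m+[n∸m]≡n ∣y∣≤r))))
            (intervalLayer≡C y G (t ∸ ∣ y ∣) (r ∸ ∣ y ∣) y⊆G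
              (trans (≡ᵇ⇒≡ _ _ (true⇒T ∣G∣≡t)) (sym (m+[n∸m]≡n (≤-trans ∣y∣≤r r≤t)))))

  chains-lastTrue : DownClosed K → ∀ {r w t} (y : Subset n) → ∣ y ∣ < r → LastTrue r w t →
                    chains y r w ≡ facesAbove y t * booleanFlags t ∣ y ∣ r w
  chains-lastTrue down {r} y _ (here {w = w} all) =
    begin
      ∑[ S ← Ss ] inLayerAbove y r S * chains S (suc r) w
    ≡⟨ ∑-cong Ss (λ S → trans (cong (inLayerAbove y r S *_) (chains-allFalse S (suc r) all)) (*-identityʳ _)) ⟩
      facesAbove y r
    ≡⟨ sym (*-identityʳ _) ⟩
      facesAbove y r * 1
    ≡⟨ cong (facesAbove y r *_) (sym (cong₂ _*_ (nCn≡1 (r ∸ ∣ y ∣)) (booleanFlags-allFalse r r (suc r) all))) ⟩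
      facesAbove y r * booleanFlags r ∣ y ∣ r (true ∷ w)
    ∎
    where
    open ≡-Reasoning
    Ss = allSubsets n
  chains-lastTrue down y ∣y∣<r (there {b = false} l) = chains-lastTrue down y (m<n⇒m<1+n ∣y∣<r) l
  chains-lastTrue down {r} y ∣y∣<r (there {b = true} {w} {t} l) =
    begin
      ∑[ S ← Ss ] inLayerAbove y r S * chains S (suc r) w
    ≡⟨ ∑-cong Ss (λ S → 𝟙-*-cong (K S ∧ ((∣ S ∣ ≡ᵇ r) ∧ y ⊆ᵇ S)) (chains-S S)) ⟩
      ∑[ S ← Ss ] inLayerAbove y r S * (facesAbove S t * flags)
    ≡⟨ ∑-cong Ss (λ S → sym (*-assoc (inLayerAbove y r S) (facesAbove S t) flags)) ⟩
      ∑[ S ← Ss ] inLayerAbove y r S * facesAbove S t * flags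
    ≡⟨ ∑-*ʳ Ss flags (λ S → inLayerAbove y r S * facesAbove S t) ⟩
      (∑[ S ← Ss ] inLayerAbove y r S * facesAbove S t) * flags
    ≡⟨ cong (_* flags) (∑-facesAbove down y r t (<⇒≤ ∣y∣<r) (≤-trans (n≤1+n r) (LastTrue⇒≤ l))) ⟩
      facesAbove y t * ((t ∸ ∣ y ∣) C (r ∸ ∣ y ∣)) * flags
    ≡⟨ *-assoc (facesAbove y t) _ flags ⟩
      facesAbove y t * booleanFlags t ∣ y ∣ r (true ∷ w)
    ∎
    where
    open ≡-Reasoning
    Ss = allSubsets n
    flags = booleanFlags t r (suc r) w
    chains-S : ∀ S → (K S ∧ ((∣ S ∣ ≡ᵇ r) ∧ y ⊆ᵇ S)) ≡ true → chains S (suc r) w ≡ facesAbove S t * flags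
    chains-S S S-above with K S | ∣ S ∣ ≡ᵇ r in ∣S∣≡r | y ⊆ᵇ S
    ... | true | true | true =
      trans (chains-lastTrue down S (s≤s (≤-reflexive ∣S∣≡r′)) l)
            (cong (λ s → facesAbove S t * booleanFlags t s (suc r) w) ∣S∣≡r′)
      where ∣S∣≡r′ = ≡ᵇ⇒≡ _ _ (true⇒T ∣S∣≡r)

faceNumber : ∀ {n} → (Subset n → Bool) → ℕ → ℕ
faceNumber {n} K t = ∑[ G ← allSubsets n ] 𝟙 (K G ∧ (∣ G ∣ ≡ᵇ t))

facesAbove-⊥ : ∀ {n} (K : Subset n → Bool) t → facesAbove K ⊥ t ≡ faceNumber K t
facesAbove-⊥ {n} K t =
  ∑-cong (allSubsets n) (λ G → cong (λ b → 𝟙 (K G ∧ b)) (trans (cong ((∣ G ∣ ≡ᵇ t) ∧_) (⊥⊆ᵇ G)) (∧-identityʳ _)))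

chains-from-⊥ : ∀ {n} (K : Subset n → Bool) → DownClosed K → ∀ {w t} → LastTrue 1 w t →
                chains K ⊥ 1 w ≡ faceNumber K t * booleanFlags t 0 1 w
chains-from-⊥ {n} K down {w} {t} l =
  trans (chains-lastTrue K down ⊥ (s≤s (≤-reflexive (∣⊥∣≡0 n))) l)
        (cong₂ (λ f s → f * booleanFlags t s 1 w) (facesAbove-⊥ K t) (∣⊥∣≡0 n))

everySubset : ∀ {n} → Subset n → Bool
everySubset _ = true

downClosed-everySubset : ∀ {n} → DownClosed (everySubset {n})
downClosed-everySubset _ _ _ _ = refl

facesAbove-everySubset : ∀ n t → facesAbove (everySubset {n}) ⊥ t ≡ n C t
facesAbove-everySubset n t =
  trans (∑-cong (allSubsets n) (λ G → cong 𝟙 (trans (cong ((∣ G ∣ ≡ᵇ t) ∧_) (⊥⊆ᵇ G))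
                                                    (trans (∧-identityʳ _) (cong (_∧ (∣ G ∣ ≡ᵇ t)) (sym (⊆ᵇ⊤ G)))))))
        (trans (subsetsOfSize≡C (⊤ {n}) t) (cong (_C t) (∣⊤∣≡n n)))

faceNumber-everySubset : ∀ m t → faceNumber (everySubset {m}) t ≡ m C t
faceNumber-everySubset m t = trans (sym (facesAbove-⊥ (everySubset {m}) t)) (facesAbove-everySubset m t)

-- The top of a Boolean lattice is its unique element of full rank.
chains-∷ʳtop : ∀ m (y : Subset m) r w → r + length w ≡ m →
               chains everySubset y r (w ∷ʳ true) ≡ chains everySubset y r w
chains-∷ʳtop m y r [] r+0≡m =
  trans (∑-cong (allSubsets m) (λ S → trans (*-identityʳ _) (cong 𝟙 (full S))))
        (trans (intervalLayer≡C y ⊤ (m ∸ ∣ y ∣) (m ∸ ∣ y ∣) (⊆ᵇ⊤ y) ∣⊤∣≡∣y∣+)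
               (nCn≡1 (m ∸ ∣ y ∣)))
  where
  ∣⊤∣≡∣y∣+ : ∣ ⊤ {m} ∣ ≡ ∣ y ∣ + (m ∸ ∣ y ∣)
  ∣⊤∣≡∣y∣+ = trans (∣⊤∣≡n m) (sym (m+[n∸m]≡n (∣p∣≤n y)))
  full : ∀ S → ((∣ S ∣ ≡ᵇ r) ∧ y ⊆ᵇ S) ≡ (S ⊆ᵇ ⊤ ∧ (y ⊆ᵇ S ∧ (∣ S ∣ ≡ᵇ ∣ y ∣ + (m ∸ ∣ y ∣))))
  full S = trans (∧-comm (∣ S ∣ ≡ᵇ r) (y ⊆ᵇ S))
                 (cong₂ (λ a j → a ∧ (y ⊆ᵇ S ∧ (∣ S ∣ ≡ᵇ j))) (sym (⊆ᵇ⊤ S))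
                        (trans (sym (+-identityʳ r)) (trans r+0≡m (sym (trans (sym ∣⊤∣≡∣y∣+) (∣⊤∣≡n m))))))
chains-∷ʳtop m y r (false ∷ w) fits = chains-∷ʳtop m y (suc r) w (trans (sym (+-suc r (length w))) fits)
chains-∷ʳtop m y r (true ∷ w)  fits =
  ∑-cong (allSubsets m) (λ S → cong (inLayerAbove everySubset y r S *_)
                                    (chains-∷ʳtop m S (suc r) w (trans (sym (+-suc r (length w))) fits)))

faceOf : ∀ {n} → List (Subset n) → Subset n → Bool
faceOf Fs G = any (G ⊆ᵇ_) Fs

downClosed-faceOf : ∀ {n} (Fs : List (Subset n)) → DownClosed (faceOf Fs)
downClosed-faceOf (F ∷ Fs) S G G∈ S⊆G with G ⊆ᵇ F in G⊆F
... | true rewrite ⊆ᵇ-trans S G F S⊆G G⊆F = refl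
... | false with S ⊆ᵇ F
...   | true  = refl
...   | false = downClosed-faceOf Fs S G G∈ S⊆G

-- Flag numbers of the simplex and of a simplicial polytope

α-simplex : ∀ j w → α (simplexLattice j) w ≡ chains (everySubset {suc j}) ⊥ 1 w
α-simplex j = fromBottom 1
  where
  L = simplexLattice j
  Ss = allSubsets (suc j)
  fromFace : ∀ y r w → chainCount L (inj₁ y) r w ≡ chains (everySubset {suc j}) y r w
  fromFace y r []          = refl
  fromFace y r (false ∷ w) = fromFace y (suc r) w
  fromFace y r (true ∷ w)  =
    trans (∑-filter _ _ Ss) (∑-cong Ss (λ S →
      trans (if-𝟙 ((∣ S ∣ ≡ᵇ r) ∧ does (y ⊆? S)) _)
            (cong₂ (λ b x → 𝟙 ((∣ S ∣ ≡ᵇ r) ∧ b) * x) (does-⊆? y S) (fromFace S (suc r) w))))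
  fromBottom : ∀ r w → chainCount L (inj₂ tt) r w ≡ chains (everySubset {suc j}) ⊥ r w
  fromBottom r []          = refl
  fromBottom r (false ∷ w) = fromBottom (suc r) w
  fromBottom r (true ∷ w)  =
    trans (∑-filter _ _ Ss) (∑-cong Ss (λ S →
      trans (if-𝟙 ((∣ S ∣ ≡ᵇ r) ∧ true) _)
            (cong₂ (λ b x → 𝟙 ((∣ S ∣ ≡ᵇ r) ∧ b) * x) (sym (⊥⊆ᵇ S)) (fromFace S (suc r) w))))

α-simplex-lastTrue : ∀ j {w t} → LastTrue 1 w t → α (simplexLattice j) w ≡ (suc j C t) * booleanFlags t 0 1 w
α-simplex-lastTrue j {w} {t} l =
  trans (α-simplex j w) (trans (chains-from-⊥ everySubset downClosed-everySubset l)
                               (cong (_* booleanFlags t 0 1 w) (faceNumber-everySubset (suc j) t)))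

module _ (d n : ℕ) (Fs : List (Subset n)) where

  private
    P = polytopeLattice d n Fs
    Ss = allSubsets n

  ∑-polytopeElems : ∀ (cond : Elt P → Bool) h → cond (inj₂ tt) ≡ false →
                    ∑ (filterᵇ' cond (elems P)) h ≡ ∑[ S ← Ss ] 𝟙 (faceOf Fs S ∧ cond (inj₁ S)) * h (inj₁ S)
  ∑-polytopeElems cond h top∉ =
    begin
      ∑ (filterᵇ' cond (elems P)) h
    ≡⟨ ∑-filter cond h (elems P) ⟩
      ∑ (map inj₁ (boundaryFaces Fs) ++ inj₂ tt ∷ []) h′
    ≡⟨ ∑-++ (map inj₁ (boundaryFaces Fs)) _ h′ ⟩
      ∑ (map inj₁ (boundaryFaces Fs)) h′ + (h′ (inj₂ tt) + 0)
    ≡⟨ cong₂ _+_ (∑-map inj₁ (boundaryFaces Fs) h′) (cong (λ b → (if b then h (inj₂ tt) else 0) + 0) top∉) ⟩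
      ∑ (boundaryFaces Fs) (h′ ∘ inj₁) + 0
    ≡⟨ +-identityʳ _ ⟩
      ∑ (boundaryFaces Fs) (h′ ∘ inj₁)
    ≡⟨ ∑-filter _ (h′ ∘ inj₁) Ss ⟩
      ∑[ S ← Ss ] (if any (λ F → does (S ⊆? F)) Fs then h′ (inj₁ S) else 0)
    ≡⟨ ∑-cong Ss (λ S → trans (if-if-𝟙 (any (λ F → does (S ⊆? F)) Fs) (cond (inj₁ S)) (h (inj₁ S)))
                                    (cong (λ b → 𝟙 (b ∧ cond (inj₁ S)) * h (inj₁ S)) (faceOf-does S))) ⟩
      ∑[ S ← Ss ] 𝟙 (faceOf Fs S ∧ cond (inj₁ S)) * h (inj₁ S)
    ∎
    where
    open ≡-Reasoning
    h′ : Elt P → ℕ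
    h′ x = if cond x then h x else 0
    faceOf-does : ∀ S → any (λ F → does (S ⊆? F)) Fs ≡ faceOf Fs S
    faceOf-does S = cong or (map-cong (does-⊆? S) Fs)

  α-polytope : ∀ w → length w ≤ d → α P w ≡ chains (faceOf Fs) ⊥ 1 w
  α-polytope w ∣w∣≤d = fromBottom 1 w (s≤s ∣w∣≤d)
    where
    top∉ : ∀ r w → r + length (true ∷ w) ≤ suc d → ((suc d ≡ᵇ r) ∧ true) ≡ false
    top∉ r w fits = cong (_∧ true) (≢⇒≡ᵇ≡false (suc d) r (>⇒≢ (≤-trans (m<m+n r (s≤s z≤n)) fits)))
    shift : ∀ r b w → r + length (b ∷ w) ≤ suc d → suc r + length w ≤ suc d
    shift r b w = subst (_≤ suc d) (+-suc r (length w))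
    fromFace : ∀ y r w → r + length w ≤ suc d → chainCount P (inj₁ (inj₁ y)) r w ≡ chains (faceOf Fs) y r w
    fromFace y r []          _    = refl
    fromFace y r (false ∷ w) fits = fromFace y (suc r) w (shift r false w fits)
    fromFace y r (true ∷ w)  fits =
      trans (∑-polytopeElems _ _ (top∉ r w fits)) (∑-cong Ss (λ S →
        cong₂ (λ b x → 𝟙 (faceOf Fs S ∧ ((∣ S ∣ ≡ᵇ r) ∧ b)) * x)
              (does-⊆? y S) (fromFace S (suc r) w (shift r true w fits))))
    fromBottom : ∀ r w → r + length w ≤ suc d → chainCount P (inj₂ tt) r w ≡ chains (faceOf Fs) ⊥ r w
    fromBottom r []          _    = refl
    fromBottom r (false ∷ w) fits = fromBottom (suc r) w (shift r false w fits)
    fromBottom r (true ∷ w)  fits =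
      trans (∑-polytopeElems _ _ (top∉ r w fits)) (∑-cong Ss (λ S →
        cong₂ (λ b x → 𝟙 (faceOf Fs S ∧ ((∣ S ∣ ≡ᵇ r) ∧ b)) * x)
              (sym (⊥⊆ᵇ S)) (fromFace S (suc r) w (shift r true w fits))))

  α-polytope-lastTrue : ∀ {w t} → length w ≤ d → LastTrue 1 w t →
                        α P w ≡ faceNumber (faceOf Fs) t * booleanFlags t 0 1 w
  α-polytope-lastTrue {w} ∣w∣≤d l =
    trans (α-polytope w ∣w∣≤d) (chains-from-⊥ (faceOf Fs) (downClosed-faceOf Fs) l)

-- Face numbers of stacked polytopes

coverCount : ∀ {n} → Subset n → List (Subset n) → ℕ
coverCount G Fs = ∑[ F ← Fs ] 𝟙 (G ⊆ᵇ F)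

IrredundantFacets : ∀ {n} → ℕ → List (Subset n) → Set
IrredundantFacets d Fs = ∀ {F} → F ∈ Fs → ∣ F ∣ ≡ d × coverCount F Fs ≡ 1

module _ {n : ℕ} (F : Subset n) where

  any-newFacets : ∀ X → any (X ⊆ᵇ_) (newFacets F) ≡ anyᶠ (λ v → lookup F v ∧ X ⊆ᵇ (inside ∷ᵥ (F - v)))
  any-newFacets X =
    trans (any-map (X ⊆ᵇ_) (λ v → inside ∷ᵥ (F - v)) (filterᵇ' (lookup F) (toList (allFin n))))
          (trans (any-filter (λ v → X ⊆ᵇ (inside ∷ᵥ (F - v))) (lookup F) (toList (allFin n)))
                 (any-tabulate (λ v → lookup F v ∧ X ⊆ᵇ (inside ∷ᵥ (F - v))) (λ v → v)))

  ∑-newFacets : ∀ f → ∑ (newFacets F) f ≡ sumᶠ (λ v → if lookup F v then f (inside ∷ᵥ (F - v)) else 0)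
  ∑-newFacets f =
    trans (∑-map (λ v → inside ∷ᵥ (F - v)) (filterᵇ' (lookup F) (toList (allFin n))) f)
          (trans (∑-filter (lookup F) (λ v → f (inside ∷ᵥ (F - v))) (toList (allFin n)))
                 (∑-tabulate (λ v → v) (λ v → if lookup F v then f (inside ∷ᵥ (F - v)) else 0)))

module _ (d : ℕ) where

  private
    Fs₀ = simplexFacets d

  faceOf-simplexFacets : ∀ G → faceOf Fs₀ G ≡ G ⊂ᵇ ⊤
  faceOf-simplexFacets G =
    trans (any-map (G ⊆ᵇ_) (λ i → ∁ ⁅ i ⁆) (toList (allFin (suc d))))
          (trans (any-tabulate (λ i → G ⊆ᵇ ∁ ⁅ i ⁆) (λ i → i))
                 (anyᶠ-cong (λ i → trans (cong (G ⊆ᵇ_) (∁⁅i⁆≡⊤-i i)) (cong (_∧ G ⊆ᵇ (⊤ - i)) (sym (lookup-⊤ i))))))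

  faceNumber-simplexFacets : ∀ t → t ≢ suc d → faceNumber (faceOf Fs₀) t ≡ suc d C t
  faceNumber-simplexFacets t t≢ =
    trans (∑-cong (allSubsets (suc d)) (λ G → cong (λ b → 𝟙 (b ∧ (∣ G ∣ ≡ᵇ t))) (faceOf-simplexFacets G)))
          (trans (properSubsetsOfSize≡C (⊤ {suc d}) t (λ t≡ → t≢ (trans t≡ (∣⊤∣≡n (suc d)))))
                 (cong (_C t) (∣⊤∣≡n (suc d))))

  irredundant-simplexFacets : IrredundantFacets d Fs₀
  irredundant-simplexFacets F∈ with ∈-map⁻ (λ i → ∁ ⁅ i ⁆) {xs = toList (allFin (suc d))} F∈
  ... | i , _ , refl = size , cover
    where
    size : ∣ ∁ ⁅ i ⁆ ∣ ≡ d
    size = suc-injective (trans (cong (suc ∘ ∣_∣) (∁⁅i⁆≡⊤-i i))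
                                (trans (suc∣p-x∣≡∣p∣ (⊤ {suc d}) i (lookup-⊤ i)) (∣⊤∣≡n (suc d))))
    cover : coverCount (∁ ⁅ i ⁆) Fs₀ ≡ 1
    cover =
      trans (∑-map (λ j → ∁ ⁅ j ⁆) (toList (allFin (suc d))) (λ F → 𝟙 (∁ ⁅ i ⁆ ⊆ᵇ F)))
            (trans (∑-tabulate (λ j → j) (λ j → 𝟙 (∁ ⁅ i ⁆ ⊆ᵇ ∁ ⁅ j ⁆)))
                   (trans (sumᶠ-cong (λ j → trans (cong₂ (λ p q → 𝟙 (p ⊆ᵇ q)) (∁⁅i⁆≡⊤-i i) (∁⁅i⁆≡⊤-i j))
                                                  (cong (λ b → 𝟙 (b ∧ (⊤ - i) ⊆ᵇ (⊤ - j))) (sym (lookup-⊤ j)))))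
                          (facets-containing-p-x≡1 (⊤ {suc d}) i (lookup-⊤ i))))

module Stacking {d n : ℕ} {Fs : List (Subset n)} {F : Subset n}
                (F∈Fs : F ∈ Fs) (irredundant : IrredundantFacets d Fs) where

  Fs′ : List (Subset (suc n))
  Fs′ = newFacets F ++ map (outside ∷ᵥ_) (Fs ─ F∈Fs)

  private
    Ss = allSubsets n
    others : Subset n → Bool
    others = faceOf (Fs ─ F∈Fs)

  ∣F∣≡d : ∣ F ∣ ≡ d
  ∣F∣≡d = proj₁ (irredundant F∈Fs)

  coverCount-removed : ∀ G → coverCount G Fs ≡ 𝟙 (G ⊆ᵇ F) + coverCount G (Fs ─ F∈Fs)
  coverCount-removed G = ∑-─ (λ F′ → 𝟙 (G ⊆ᵇ F′)) F∈Fs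

  F∉others : others F ≡ false
  F∉others = ∑-𝟙≡0 (F ⊆ᵇ_) (Fs ─ F∈Fs)
    (+-cancelˡ-≡ 1 _ _
      (trans (sym (trans (coverCount-removed F) (cong (λ b → 𝟙 b + coverCount F (Fs ─ F∈Fs)) (⊆ᵇ-refl F))))
             (proj₂ (irredundant F∈Fs))))

  faceOf-outside : ∀ G → faceOf Fs′ (outside ∷ᵥ G) ≡ G ⊂ᵇ F ∨ others G
  faceOf-outside G =
    trans (any-++ _ (newFacets F) _)
          (cong₂ _∨_ (any-newFacets F (outside ∷ᵥ G)) (any-map _ (outside ∷ᵥ_) (Fs ─ F∈Fs)))

  faceOf-inside : ∀ G → faceOf Fs′ (inside ∷ᵥ G) ≡ G ⊂ᵇ F
  faceOf-inside G =
    trans (any-++ _ (newFacets F) _)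
          (trans (cong₂ _∨_ (any-newFacets F (inside ∷ᵥ G))
                            (trans (any-map _ (outside ∷ᵥ_) (Fs ─ F∈Fs)) (any-false (Fs ─ F∈Fs))))
                 (∨-identityʳ _))

  -- The faces of Fs are those of the new complex not containing the new vertex, together with F.
  faceOf-split : ∀ G → faceOf Fs G ≡ (G ⊂ᵇ F ∨ others G) ∨ G == F
  faceOf-split G =
    begin
      faceOf Fs G
    ≡⟨ any-─ (G ⊆ᵇ_) F∈Fs ⟩
      G ⊆ᵇ F ∨ others G
    ≡⟨ cong (_∨ others G) (⊆ᵇ≡⊂ᵇ∨== G F) ⟩
      (G ⊂ᵇ F ∨ G == F) ∨ others G
    ≡⟨ ∨-assoc (G ⊂ᵇ F) _ _ ⟩
      G ⊂ᵇ F ∨ (G == F ∨ others G)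
    ≡⟨ cong (G ⊂ᵇ F ∨_) (∨-comm (G == F) _) ⟩
      G ⊂ᵇ F ∨ (others G ∨ G == F)
    ≡⟨ sym (∨-assoc (G ⊂ᵇ F) _ _) ⟩
      (G ⊂ᵇ F ∨ others G) ∨ G == F
    ∎
    where open ≡-Reasoning

  faceOf-split-disjoint : ∀ G → ((G ⊂ᵇ F ∨ others G) ∧ G == F) ≡ false
  faceOf-split-disjoint G with G == F in G=F
  ... | false = ∧-zeroʳ _
  ... | true rewrite ==⇒≡ G F G=F | ⊂ᵇ-irrefl F | F∉others = refl

  faceNumber-avoiding-new : ∀ t →
    ∑[ G ← Ss ] 𝟙 (faceOf Fs′ (outside ∷ᵥ G) ∧ (∣ G ∣ ≡ᵇ t)) + 𝟙 (d ≡ᵇ t) ≡ faceNumber (faceOf Fs) t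
  faceNumber-avoiding-new t =
    begin
      outer + 𝟙 (d ≡ᵇ t)
    ≡⟨ cong (λ m → outer + 𝟙 (m ≡ᵇ t)) (sym ∣F∣≡d) ⟩
      outer + 𝟙 (size F)
    ≡⟨ cong (outer +_) (sym (∑-== F size)) ⟩
      outer + ∑[ G ← Ss ] 𝟙 (G == F ∧ size G)
    ≡⟨ sym (∑-+ Ss _ _) ⟩
      ∑[ G ← Ss ] (𝟙 (faceOf Fs′ (outside ∷ᵥ G) ∧ size G) + 𝟙 (G == F ∧ size G))
    ≡⟨ ∑-cong Ss (λ G → trans (cong (λ b → 𝟙 (b ∧ size G) + 𝟙 (G == F ∧ size G)) (faceOf-outside G))
                              (𝟙-∨-disjoint _ (G == F) (size G) (faceOf-split-disjoint G))) ⟩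
      ∑[ G ← Ss ] 𝟙 (((G ⊂ᵇ F ∨ others G) ∨ G == F) ∧ size G)
    ≡⟨ ∑-cong Ss (λ G → cong (λ b → 𝟙 (b ∧ size G)) (sym (faceOf-split G))) ⟩
      faceNumber (faceOf Fs) t
    ∎
    where
    open ≡-Reasoning
    size : Subset n → Bool
    size G = ∣ G ∣ ≡ᵇ t
    outer = ∑[ G ← Ss ] 𝟙 (faceOf Fs′ (outside ∷ᵥ G) ∧ size G)

  faceNumber-containing-new : ∀ t → t < d → ∑[ G ← Ss ] 𝟙 (faceOf Fs′ (inside ∷ᵥ G) ∧ (∣ G ∣ ≡ᵇ t)) ≡ d C t
  faceNumber-containing-new t t<d =
    trans (∑-cong Ss (λ G → cong (λ b → 𝟙 (b ∧ (∣ G ∣ ≡ᵇ t))) (faceOf-inside G)))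
          (trans (properSubsetsOfSize≡C F t (λ t≡∣F∣ → <⇒≢ t<d (trans t≡∣F∣ ∣F∣≡d))) (cong (_C t) ∣F∣≡d))

  faceNumber-step : ∀ t → t < d →
                    faceNumber (faceOf Fs′) (suc t) + 𝟙 (d ≡ᵇ suc t) ≡ faceNumber (faceOf Fs) (suc t) + d C t
  faceNumber-step t t<d =
    begin
      faceNumber (faceOf Fs′) (suc t) + 𝟙 (d ≡ᵇ suc t)
    ≡⟨ cong (_+ 𝟙 (d ≡ᵇ suc t)) (∑-allSubsets (λ G → 𝟙 (faceOf Fs′ G ∧ (∣ G ∣ ≡ᵇ suc t)))) ⟩
      avoiding + containing + 𝟙 (d ≡ᵇ suc t)
    ≡⟨ xy∙z≈xz∙y avoiding containing _ ⟩
      avoiding + 𝟙 (d ≡ᵇ suc t) + containing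
    ≡⟨ cong₂ _+_ (faceNumber-avoiding-new (suc t)) (faceNumber-containing-new t t<d) ⟩
      faceNumber (faceOf Fs) (suc t) + d C t
    ∎
    where
    open ≡-Reasoning
    avoiding = ∑[ G ← Ss ] 𝟙 (faceOf Fs′ (outside ∷ᵥ G) ∧ (∣ G ∣ ≡ᵇ suc t))
    containing = ∑[ G ← Ss ] 𝟙 (faceOf Fs′ (inside ∷ᵥ G) ∧ (∣ G ∣ ≡ᵇ t))

  newFacet-cover : ∀ v → lookup F v ≡ true → coverCount (inside ∷ᵥ (F - v)) Fs′ ≡ 1
  newFacet-cover v v∈F =
    trans (∑-++ (newFacets F) _ _)
          (cong₂ _+_ (trans (∑-newFacets F _)
                            (trans (sumᶠ-cong (λ u → if-𝟙-∧ (lookup F u) ((F - v) ⊆ᵇ (F - u))))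
                                   (facets-containing-p-x≡1 F v v∈F)))
                     (trans (∑-map (outside ∷ᵥ_) (Fs ─ F∈Fs) _) (∑-zero (Fs ─ F∈Fs))))

  oldFacet-cover : ∀ {F″} → F″ ∈ (Fs ─ F∈Fs) → coverCount (outside ∷ᵥ F″) Fs′ ≡ 1
  oldFacet-cover {F″} F″∈ =
    trans (∑-++ (newFacets F) _ _)
          (cong₂ _+_ (trans (∑-newFacets F _) (sumᶠ-zero not-in-new))
                     (trans (∑-map (outside ∷ᵥ_) (Fs ─ F∈Fs) _) (proj₂ split)))
    where
    split : (F″ ⊆ᵇ F) ≡ false × coverCount F″ (Fs ─ F∈Fs) ≡ 1
    split = 𝟙+≡1 (F″ ⊆ᵇ F) _ (≤-trans (≤-reflexive (cong 𝟙 (sym (⊆ᵇ-refl F″)))) (∑-≥ (λ F′ → 𝟙 (F″ ⊆ᵇ F′)) F″∈))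
                 (trans (sym (coverCount-removed F″)) (proj₂ (irredundant (∈-─⁻ F∈Fs F″∈))))
    not-in-new : ∀ u → (if lookup F u then 𝟙 (F″ ⊆ᵇ (F - u)) else 0) ≡ 0
    not-in-new u with lookup F u
    ... | false = refl
    ... | true with F″ ⊆ᵇ (F - u) in F″⊆F-u
    ...   | false = refl
    ...   | true  with () ← trans (sym (proj₁ split)) (⊆ᵇ-trans F″ (F - u) F F″⊆F-u (p-x⊆ᵇp F u))

  irredundant-step : IrredundantFacets d Fs′
  irredundant-step G∈ with ∈-++⁻ (newFacets F) G∈
  ... | inj₁ G∈new with ∈-map⁻ (λ v → inside ∷ᵥ (F - v)) G∈new
  ...   | v , v∈ , refl = trans (suc∣p-x∣≡∣p∣ F v v∈F) ∣F∣≡d , newFacet-cover v v∈F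
    where v∈F = ∈-filter⁻ (lookup F) (toList (allFin n)) v∈
  irredundant-step G∈ | inj₂ G∈old with ∈-map⁻ (outside ∷ᵥ_) G∈old
  ...   | F″ , F″∈ , refl = proj₁ (irredundant (∈-─⁻ F∈Fs F″∈)) , oldFacet-cover F″∈

stacked-faceNumbers :
  ∀ {d k n Fs} → Stacked d k n Fs →
  IrredundantFacets d Fs ×
  (∀ t → t < d → let e = d C suc t + 𝟙 (d ≡ᵇ suc t) in
                 faceNumber (faceOf Fs) (suc t) + k * e ≡ e + k * (suc d C suc t))
stacked-faceNumbers {d} base =
  irredundant-simplexFacets d , λ t t<d →
    trans (cong (_+ 1 * (d C suc t + 𝟙 (d ≡ᵇ suc t))) (faceNumber-simplexFacets d (suc t) (<⇒≢ t<d ∘ suc-injective)))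
          (one-simplex (suc d C suc t) (d C suc t + 𝟙 (d ≡ᵇ suc t)))
  where
  one-simplex : ∀ Y e → Y + 1 * e ≡ e + 1 * Y
  one-simplex = solve-∀
stacked-faceNumbers {d} (stack {k} st F∈Fs) with stacked-faceNumbers st
... | irredundant , counts =
  Stacking.irredundant-step F∈Fs irredundant , λ t t<d →
    one-more-simplex (Stacking.faceNumber-step F∈Fs irredundant t t<d)
                     (nCk+nC[k+1]≡[n+1]C[k+1] d t) (counts t t<d)
  where
  one-more-simplex : ∀ {f f′ C₀ C₁ e Y} → f′ + e ≡ f + C₀ → C₀ + C₁ ≡ Y →
                     f + k * (C₁ + e) ≡ (C₁ + e) + k * Y → f′ + suc k * (C₁ + e) ≡ (C₁ + e) + suc k * Y
  one-more-simplex {f} {f′} {C₀} {C₁} {e} {Y} step pascal count =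
    begin
      f′ + suc k * (C₁ + e)
    ≡⟨ regroup₁ f′ e C₁ k ⟩
      (f′ + e) + (C₁ + k * (C₁ + e))
    ≡⟨ cong (_+ (C₁ + k * (C₁ + e))) step ⟩
      (f + C₀) + (C₁ + k * (C₁ + e))
    ≡⟨ regroup₂ f C₀ C₁ k e ⟩
      (f + k * (C₁ + e)) + (C₀ + C₁)
    ≡⟨ cong₂ _+_ count pascal ⟩
      (C₁ + e) + k * Y + Y
    ≡⟨ regroup₃ (C₁ + e) k Y ⟩
      (C₁ + e) + suc k * Y
    ∎
    where
    open ≡-Reasoning
    regroup₁ : ∀ f′ e C₁ k → f′ + suc k * (C₁ + e) ≡ (f′ + e) + (C₁ + k * (C₁ + e))
    regroup₁ = solve-∀
    regroup₂ : ∀ f C₀ C₁ k e → (f + C₀) + (C₁ + k * (C₁ + e)) ≡ (f + k * (C₁ + e)) + (C₀ + C₁)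
    regroup₂ = solve-∀
    regroup₃ : ∀ X k Y → X + k * Y + Y ≡ X + suc k * Y
    regroup₃ = solve-∀

-- Flag numbers of stacked polytopes

scale-identity : ∀ f e Y k g → f + k * e ≡ e + k * Y → f * g + k * (e * g) ≡ e * g + k * (Y * g)
scale-identity f e Y k g eq =
  trans (distribute f e k g) (trans (cong (_* g) eq) (sym (distribute e Y k g)))
  where
  distribute : ∀ a b k g → a * g + k * (b * g) ≡ (a + k * b) * g
  distribute = solve-∀

module _ {d₀ k n : ℕ} {Fs : List (Subset n)} (st : Stacked (suc d₀) k n Fs) where

  private
    d = suc d₀
    αP αD αE : List Bool → ℕ
    αP = α (polytopeLattice d n Fs)
    αD = α (simplexLattice d)
    αE = α (simplexLattice d₀)
    fP = faceNumber (faceOf Fs)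
    faceNumbers = proj₂ (stacked-faceNumbers st)

  α-stacked-∷ʳfalse : ∀ T → length T ≡ d₀ → αP (T ∷ʳ false) + k * αE T ≡ αE T + k * αD (T ∷ʳ false)
  α-stacked-∷ʳfalse T ∣T∣≡d₀ with lastTrue? 1 T
  ... | inj₁ all =
    trans (cong₂ (λ p e → p + k * e)
                 (trans (α-polytope d n Fs (T ∷ʳ false) ∣Tf∣≤d) (chains-allFalse (faceOf Fs) ⊥ 1 (∷ʳ⁺ all refl)))
                 αE≡1)
          (sym (cong₂ (λ e q → e + k * q)
                      αE≡1 (trans (α-simplex d (T ∷ʳ false)) (chains-allFalse everySubset ⊥ 1 (∷ʳ⁺ all refl)))))
    where
    ∣Tf∣≤d = ≤-reflexive (trans (length-∷ʳ T false) (cong suc ∣T∣≡d₀))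
    αE≡1 = trans (α-simplex d₀ T) (chains-allFalse everySubset ⊥ 1 all)
  ... | inj₂ (zero , l)  with () ← LastTrue⇒≤ l
  ... | inj₂ (suc t , l) =
    begin
      αP (T ∷ʳ false) + k * αE T
    ≡⟨ cong₂ (λ p e → p + k * e) (α-polytope-lastTrue d n Fs ∣Tf∣≤d (LastTrue-∷ʳfalse l)) αE≡ ⟩
      fP (suc t) * g + k * ((d C suc t) * g)
    ≡⟨ scale-identity _ _ _ k g faceNumber-identity ⟩
      (d C suc t) * g + k * ((suc d C suc t) * g)
    ≡⟨ cong₂ (λ e q → e + k * q) (sym αE≡) (sym (α-simplex-lastTrue d (LastTrue-∷ʳfalse l))) ⟩
      αE T + k * αD (T ∷ʳ false)
    ∎
    where
    open ≡-Reasoning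
    ∣Tf∣≤d = ≤-reflexive (trans (length-∷ʳ T false) (cong suc ∣T∣≡d₀))
    g = booleanFlags (suc t) 0 1 (T ∷ʳ false)
    suc-t<d : suc t < d
    suc-t<d = subst (suc t <_) (cong suc ∣T∣≡d₀) (LastTrue⇒< l)
    αE≡ : αE T ≡ (d C suc t) * g
    αE≡ = trans (α-simplex-lastTrue d₀ l) (cong ((d C suc t) *_) (sym (booleanFlags-∷ʳfalse (suc t) 0 1 T)))
    faceNumber-identity : fP (suc t) + k * (d C suc t) ≡ d C suc t + k * (suc d C suc t)
    faceNumber-identity =
      subst (λ e → fP (suc t) + k * e ≡ e + k * (suc d C suc t))
            (trans (cong (λ b → d C suc t + 𝟙 b) (≢⇒≡ᵇ≡false d (suc t) (>⇒≢ suc-t<d))) (+-identityʳ _))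
            (faceNumbers t (≤-trans (n≤1+n (suc t)) suc-t<d))

  α-stacked-∷ʳtrue : ∀ T → length T ≡ d₀ → αP (T ∷ʳ true) + k * (2 * αE T) ≡ 2 * αE T + k * αD (T ∷ʳ true)
  α-stacked-∷ʳtrue T ∣T∣≡d₀ =
    begin
      αP (T ∷ʳ true) + k * (2 * αE T)
    ≡⟨ cong₂ (λ p e → p + k * (2 * e)) (α-polytope-lastTrue d n Fs ∣Tt∣≤d l) αE≡g ⟩
      fP d * g + k * (2 * g)
    ≡⟨ scale-identity (fP d) 2 (suc d C d) k g faceNumber-identity ⟩
      2 * g + k * ((suc d C d) * g)
    ≡⟨ cong₂ (λ e q → 2 * e + k * q) (sym αE≡g) (sym (α-simplex-lastTrue d l)) ⟩
      2 * αE T + k * αD (T ∷ʳ true)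
    ∎
    where
    open ≡-Reasoning
    ∣Tt∣≤d = ≤-reflexive (trans (length-∷ʳ T true) (cong suc ∣T∣≡d₀))
    l : LastTrue 1 (T ∷ʳ true) d
    l = subst (LastTrue 1 (T ∷ʳ true)) (cong suc ∣T∣≡d₀) (LastTrue-∷ʳtrue 1 T)
    g = booleanFlags d 0 1 (T ∷ʳ true)
    αE≡g : αE T ≡ g
    αE≡g =
      trans (α-simplex d₀ T)
            (trans (sym (chains-∷ʳtop d ⊥ 1 T (cong suc ∣T∣≡d₀)))
                   (trans (chains-from-⊥ everySubset downClosed-everySubset l)
                          (trans (cong (_* g) (trans (faceNumber-everySubset d d) (nCn≡1 d))) (*-identityˡ g))))
    faceNumber-identity : fP d + k * 2 ≡ 2 + k * (suc d C d)
    faceNumber-identity =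
      subst (λ e → fP d + k * e ≡ e + k * (suc d C d))
            (cong₂ _+_ (nCn≡1 d) (cong 𝟙 (T⇒true (≡⇒≡ᵇ d d refl))))
            (faceNumbers d₀ ≤-refl)

-- ab-polynomials and the flag h-vector

-- Imported only here: with the constructor +_ in scope, ℕ sections such as (f x +_) become ambiguous.
open import Data.Integer using (+_)

module _ {X : Set} (eq : X → X → Bool) where

  coeff-⊕ : ∀ (p q : Poly X) w → coeff eq (p ⊕ q) w ≡ coeff eq p w +ℤ coeff eq q w
  coeff-⊕ []            q w = sym (ℤ.+-identityˡ _)
  coeff-⊕ ((z , u) ∷ p) q w =
    trans (cong ((if wordEq eq u w then z else + 0) +ℤ_) (coeff-⊕ p q w))
          (sym (ℤ.+-assoc (if wordEq eq u w then z else + 0) (coeff eq p w) (coeff eq q w)))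

  coeff-⊛ : ∀ c (q : Poly X) w → coeff eq (c ⊛ q) w ≡ c *ℤ coeff eq q w
  coeff-⊛ c []            w = sym (ℤ.*-zeroʳ c)
  coeff-⊛ c ((y , u) ∷ q) w with wordEq eq u w
  ... | true  = trans (cong (c *ℤ y +ℤ_) (coeff-⊛ c q w)) (sym (ℤ.*-distribˡ-+ c y _))
  ... | false = trans (ℤ.+-identityˡ _) (trans (coeff-⊛ c q w) (cong (c *ℤ_) (sym (ℤ.+-identityˡ _))))

substCD-⊕ : ∀ p q → substCD (p ⊕ q) ≡ substCD p ⊕ substCD q
substCD-⊕ = concatMap-++ _

coeff-substCD-⊛ : ∀ c p w → coeff eqAB (substCD (c ⊛ p)) w ≡ c *ℤ coeff eqAB (substCD p) w
coeff-substCD-⊛ c []            w = sym (ℤ.*-zeroʳ c)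
coeff-substCD-⊛ c ((y , u) ∷ p) w =
  begin
    coeff eqAB (((c *ℤ y) ⊛ substWord u) ⊕ substCD (c ⊛ p)) w
  ≡⟨ coeff-⊕ eqAB ((c *ℤ y) ⊛ substWord u) _ w ⟩
    coeff eqAB ((c *ℤ y) ⊛ substWord u) w +ℤ coeff eqAB (substCD (c ⊛ p)) w
  ≡⟨ cong₂ _+ℤ_ (coeff-⊛ eqAB (c *ℤ y) (substWord u) w) (coeff-substCD-⊛ c p w) ⟩
    c *ℤ y *ℤ coeff eqAB (substWord u) w +ℤ c *ℤ coeff eqAB (substCD p) w
  ≡⟨ factor c y (coeff eqAB (substWord u) w) (coeff eqAB (substCD p) w) ⟩
    c *ℤ (y *ℤ coeff eqAB (substWord u) w +ℤ coeff eqAB (substCD p) w)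
  ≡⟨ cong (c *ℤ_) (sym (trans (coeff-⊕ eqAB (y ⊛ substWord u) (substCD p) w)
                              (cong (_+ℤ coeff eqAB (substCD p) w) (coeff-⊛ eqAB y (substWord u) w)))) ⟩
    c *ℤ coeff eqAB (substCD ((y , u) ∷ p)) w
  ∎
  where
  open ≡-Reasoning
  factor : ∀ c y a b → c *ℤ y *ℤ a +ℤ c *ℤ b ≡ c *ℤ (y *ℤ a +ℤ b)
  factor = ℤ-solve-∀

coeff-substCD-linear : ∀ a p b q w →
  coeff eqAB (substCD ((a ⊛ p) ⊕ (b ⊛ q))) w ≡ a *ℤ coeff eqAB (substCD p) w +ℤ b *ℤ coeff eqAB (substCD q) w
coeff-substCD-linear a p b q w =
  trans (cong (λ r → coeff eqAB r w) (substCD-⊕ (a ⊛ p) (b ⊛ q)))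
        (trans (coeff-⊕ eqAB (substCD (a ⊛ p)) (substCD (b ⊛ q)) w)
               (cong₂ _+ℤ_ (coeff-substCD-⊛ a p w) (coeff-substCD-⊛ b q w)))

times-a+b : Poly AB → Poly AB
times-a+b []            = []
times-a+b ((y , u) ∷ q) = (y , u ∷ʳ false) ∷ (y , u ∷ʳ true) ∷ times-a+b q

times-a+b-⊕ : ∀ p q → times-a+b (p ⊕ q) ≡ times-a+b p ⊕ times-a+b q
times-a+b-⊕ []            q = refl
times-a+b-⊕ ((y , u) ∷ p) q = cong (λ r → (y , u ∷ʳ false) ∷ (y , u ∷ʳ true) ∷ r) (times-a+b-⊕ p q)

⊛-times-a+b : ∀ c q → c ⊛ times-a+b q ≡ times-a+b (c ⊛ q)
⊛-times-a+b c []            = refl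
⊛-times-a+b c ((y , u) ∷ q) = cong (λ r → (c *ℤ y , u ∷ʳ false) ∷ (c *ℤ y , u ∷ʳ true) ∷ r) (⊛-times-a+b c q)

⊗-times-a+b : ∀ s q → s ⊗ times-a+b q ≡ times-a+b (s ⊗ q)
⊗-times-a+b []            q = refl
⊗-times-a+b ((y , v) ∷ s) q =
  trans (cong₂ _++_ (prefix q) (⊗-times-a+b s q))
        (sym (times-a+b-⊕ (map (λ { (z , u) → (y *ℤ z , v ++ u) }) q) (s ⊗ q)))
  where
  prefix : ∀ q → map (λ { (z , u) → (y *ℤ z , v ++ u) }) (times-a+b q) ≡
                 times-a+b (map (λ { (z , u) → (y *ℤ z , v ++ u) }) q)
  prefix []            = refl
  prefix ((z , u) ∷ q) =
    trans (cong₂ (λ a b → (y *ℤ z , a) ∷ (y *ℤ z , b) ∷ _)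
                 (sym (++-assoc v u [ false ])) (sym (++-assoc v u [ true ])))
          (cong (λ r → (y *ℤ z , (v ++ u) ∷ʳ false) ∷ (y *ℤ z , (v ++ u) ∷ʳ true) ∷ r) (prefix q))

substCD-⊗c : ∀ p → substCD (p ⊗ cPoly) ≡ times-a+b (substCD p)
substCD-⊗c []            = refl
substCD-⊗c ((y , u) ∷ p) =
  trans (cong₂ _++_ (trans (cong₂ _⊛_ (ℤ.*-identityʳ y) (substWord-∷ʳc u)) (⊛-times-a+b y (substWord u)))
                    (substCD-⊗c p))
        (sym (times-a+b-⊕ (y ⊛ substWord u) (substCD p)))
  where
  substWord-∷ʳc : ∀ u → substWord (u ∷ʳ cL) ≡ times-a+b (substWord u)
  substWord-∷ʳc []      = refl
  substWord-∷ʳc (x ∷ u) =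
    trans (cong (substLetter x ⊗_) (substWord-∷ʳc u)) (⊗-times-a+b (substLetter x) (substWord u))

wordEq-[]-∷ʳ : ∀ (w : List AB) x → wordEq eqAB [] (w ∷ʳ x) ≡ false
wordEq-[]-∷ʳ []      x = refl
wordEq-[]-∷ʳ (_ ∷ _) x = refl

wordEq-∷ʳ-[] : ∀ (u : List AB) a → wordEq eqAB (u ∷ʳ a) [] ≡ false
wordEq-∷ʳ-[] []      a = refl
wordEq-∷ʳ-[] (_ ∷ _) a = refl

wordEq-∷ʳ : ∀ (u w : List AB) a x → wordEq eqAB (u ∷ʳ a) (w ∷ʳ x) ≡ wordEq eqAB u w ∧ eqAB a x
wordEq-∷ʳ []      []      a x = ∧-identityʳ _
wordEq-∷ʳ []      (y ∷ w) a x = trans (cong (eqAB a y ∧_) (wordEq-[]-∷ʳ w x)) (∧-zeroʳ _)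
wordEq-∷ʳ (b ∷ u) []      a x = trans (cong (eqAB b x ∧_) (wordEq-∷ʳ-[] u a)) (∧-zeroʳ _)
wordEq-∷ʳ (b ∷ u) (y ∷ w) a x =
  trans (cong (eqAB b y ∧_) (wordEq-∷ʳ u w a x)) (sym (∧-assoc (eqAB b y) _ _))

coeff-times-a+b-[] : ∀ q → coeff eqAB (times-a+b q) [] ≡ + 0
coeff-times-a+b-[] []            = refl
coeff-times-a+b-[] ((y , u) ∷ q) rewrite wordEq-∷ʳ-[] u false | wordEq-∷ʳ-[] u true =
  trans (ℤ.+-identityˡ _) (trans (ℤ.+-identityˡ _) (coeff-times-a+b-[] q))

coeff-times-a+b-∷ʳ : ∀ q w x → coeff eqAB (times-a+b q) (w ∷ʳ x) ≡ coeff eqAB q w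
coeff-times-a+b-∷ʳ []            w x = refl
coeff-times-a+b-∷ʳ ((y , u) ∷ q) w false rewrite wordEq-∷ʳ u w false false | wordEq-∷ʳ u w true false
  with wordEq eqAB u w
... | false = trans (ℤ.+-identityˡ _) (trans (ℤ.+-identityˡ _)
                    (trans (coeff-times-a+b-∷ʳ q w false) (sym (ℤ.+-identityˡ _))))
... | true  = cong (y +ℤ_) (trans (ℤ.+-identityˡ _) (coeff-times-a+b-∷ʳ q w false))
coeff-times-a+b-∷ʳ ((y , u) ∷ q) w true rewrite wordEq-∷ʳ u w false true | wordEq-∷ʳ u w true true
  with wordEq eqAB u w
... | false = trans (ℤ.+-identityˡ _) (trans (ℤ.+-identityˡ _)
                    (trans (coeff-times-a+b-∷ʳ q w true) (sym (ℤ.+-identityˡ _))))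
... | true  = trans (ℤ.+-identityˡ _) (cong (y +ℤ_) (coeff-times-a+b-∷ʳ q w true))

times-a+b-cong : ∀ {p q} → p ≈ab q → times-a+b p ≈ab times-a+b q
times-a+b-cong {p} {q} p≈q w with initLast w
... | []       = trans (coeff-times-a+b-[] p) (sym (coeff-times-a+b-[] q))
... | w′ ∷ʳ′ x = trans (coeff-times-a+b-∷ʳ p w′ x) (trans (p≈q w′) (sym (coeff-times-a+b-∷ʳ q w′ x)))

module _ (b : AB) (h : List AB → ℤ) where

  coeff-prefixed : ∀ Ws x w → coeff eqAB (map (λ S → (h S , b ∷ S)) Ws) (x ∷ w) ≡
                              (if eqAB b x then coeff eqAB (map (λ S → (h S , S)) Ws) w else + 0)
  coeff-prefixed []       x w with eqAB b x
  ... | true  = refl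
  ... | false = refl
  coeff-prefixed (S ∷ Ws) x w with eqAB b x in b=x
  ... | true  = cong ((if wordEq eqAB S w then h S else + 0) +ℤ_)
                     (trans (coeff-prefixed Ws x w) (cong (λ c → if c then _ else + 0) b=x))
  ... | false = trans (ℤ.+-identityˡ _) (trans (coeff-prefixed Ws x w) (cong (λ c → if c then _ else + 0) b=x))

  coeff-prefixed-[] : ∀ Ws → coeff eqAB (map (λ S → (h S , b ∷ S)) Ws) [] ≡ + 0
  coeff-prefixed-[] []       = refl
  coeff-prefixed-[] (S ∷ Ws) = trans (ℤ.+-identityˡ _) (coeff-prefixed-[] Ws)

coeff-allWords : ∀ m (f : List Bool → ℤ) w →
                 coeff eqAB (map (λ S → (f S , S)) (allWords m)) w ≡ (if length w ≡ᵇ m then f w else + 0)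
coeff-allWords zero    f []      = ℤ.+-identityʳ _
coeff-allWords zero    f (x ∷ w) = refl
coeff-allWords (suc m) f w =
  trans (cong (λ p → coeff eqAB p w) (map-++ (λ S → (f S , S)) (map (false ∷_) (allWords m)) _))
        (trans (coeff-⊕ eqAB (map (λ S → (f S , S)) (map (false ∷_) (allWords m))) _ w)
               (trans (cong₂ (λ p q → coeff eqAB p w +ℤ coeff eqAB q w)
                             (sym (map-∘ (allWords m))) (sym (map-∘ (allWords m))))
                      (by-first-letter w)))
  where
  by-first-letter : ∀ w → coeff eqAB (map (λ S → (f (false ∷ S) , false ∷ S)) (allWords m)) w
                          +ℤ coeff eqAB (map (λ S → (f (true ∷ S) , true ∷ S)) (allWords m)) w
                        ≡ (if length w ≡ᵇ suc m then f w else + 0)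
  by-first-letter [] = cong₂ _+ℤ_ (coeff-prefixed-[] false (f ∘ (false ∷_)) (allWords m))
                                  (coeff-prefixed-[] true (f ∘ (true ∷_)) (allWords m))
  by-first-letter (false ∷ w) =
    trans (cong₂ _+ℤ_ (coeff-prefixed false (f ∘ (false ∷_)) (allWords m) false w)
                      (coeff-prefixed true (f ∘ (true ∷_)) (allWords m) false w))
          (trans (ℤ.+-identityʳ _) (coeff-allWords m (f ∘ (false ∷_)) w))
  by-first-letter (true ∷ w) =
    trans (cong₂ _+ℤ_ (coeff-prefixed false (f ∘ (false ∷_)) (allWords m) true w)
                      (coeff-prefixed true (f ∘ (true ∷_)) (allWords m) true w))
          (trans (ℤ.+-identityˡ _) (coeff-allWords m (f ∘ (true ∷_)) w))

0≡a*0+b*0 : ∀ a b → + 0 ≡ a *ℤ + 0 +ℤ b *ℤ + 0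
0≡a*0+b*0 = ℤ-solve-∀

sumℤ-++ : ∀ xs ys → sumℤ (xs ++ ys) ≡ sumℤ xs +ℤ sumℤ ys
sumℤ-++ []       ys = sym (ℤ.+-identityˡ _)
sumℤ-++ (x ∷ xs) ys = trans (cong (x +ℤ_) (sumℤ-++ xs ys)) (sym (ℤ.+-assoc x (sumℤ xs) (sumℤ ys)))

Σwords : ℕ → (List Bool → ℤ) → ℤ
Σwords m f = sumℤ (map f (allWords m))

Σwords-suc : ∀ m f → Σwords (suc m) f ≡ Σwords m (f ∘ (false ∷_)) +ℤ Σwords m (f ∘ (true ∷_))
Σwords-suc m f =
  trans (cong sumℤ (map-++ f (map (false ∷_) (allWords m)) _))
        (trans (sumℤ-++ (map f (map (false ∷_) (allWords m))) _)
               (cong₂ (λ p q → sumℤ p +ℤ sumℤ q) (sym (map-∘ (allWords m))) (sym (map-∘ (allWords m)))))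

Σwords-∷ʳ : ∀ m f → Σwords (suc m) f ≡ Σwords m (λ T → f (T ∷ʳ false) +ℤ f (T ∷ʳ true))
Σwords-∷ʳ zero    f = regroup (f (false ∷ [])) (f (true ∷ []))
  where
  regroup : ∀ a b → a +ℤ (b +ℤ + 0) ≡ (a +ℤ b) +ℤ + 0
  regroup = ℤ-solve-∀
Σwords-∷ʳ (suc m) f =
  trans (Σwords-suc (suc m) f)
        (trans (cong₂ _+ℤ_ (Σwords-∷ʳ m (f ∘ (false ∷_))) (Σwords-∷ʳ m (f ∘ (true ∷_))))
               (sym (Σwords-suc m (λ T → f (T ∷ʳ false) +ℤ f (T ∷ʳ true)))))

Σwords-cong : ∀ m {f g : List Bool → ℤ} → (∀ T → length T ≡ m → f T ≡ g T) → Σwords m f ≡ Σwords m g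
Σwords-cong zero    f≗g = cong (_+ℤ + 0) (f≗g [] refl)
Σwords-cong (suc m) {f} {g} f≗g =
  trans (Σwords-suc m f)
        (trans (cong₂ _+ℤ_ (Σwords-cong m (λ T ∣T∣ → f≗g (false ∷ T) (cong suc ∣T∣)))
                           (Σwords-cong m (λ T ∣T∣ → f≗g (true ∷ T) (cong suc ∣T∣))))
               (sym (Σwords-suc m g)))

sumℤ-linear : ∀ {A : Set} a b (f g : A → ℤ) xs →
              sumℤ (map (λ T → a *ℤ f T +ℤ b *ℤ g T) xs) ≡ a *ℤ sumℤ (map f xs) +ℤ b *ℤ sumℤ (map g xs)
sumℤ-linear a b f g []       = 0≡a*0+b*0 a b
sumℤ-linear a b f g (x ∷ xs) =
  trans (cong (a *ℤ f x +ℤ b *ℤ g x +ℤ_) (sumℤ-linear a b f g xs))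
        (regroup a b (f x) (g x) (sumℤ (map f xs)) (sumℤ (map g xs)))
  where
  regroup : ∀ a b fx gx F G → (a *ℤ fx +ℤ b *ℤ gx) +ℤ (a *ℤ F +ℤ b *ℤ G) ≡ a *ℤ (fx +ℤ F) +ℤ b *ℤ (gx +ℤ G)
  regroup = ℤ-solve-∀

-- By definition, β L is möbius (m L) (λ T → + α L T).
möbius : ℕ → (List Bool → ℤ) → List Bool → ℤ
möbius m f S = Σwords m (λ T → if subWordᵇ T S then sign (countTrue S ∸ countTrue T) *ℤ f T else + 0)

möbius-linear : ∀ m a b f g S → möbius m (λ T → a *ℤ f T +ℤ b *ℤ g T) S ≡ a *ℤ möbius m f S +ℤ b *ℤ möbius m g S
möbius-linear m a b f g S = trans (cong sumℤ (map-cong termwise (allWords m))) (sumℤ-linear a b _ _ (allWords m))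
  where
  termwise : ∀ T → (if subWordᵇ T S then sign (countTrue S ∸ countTrue T) *ℤ (a *ℤ f T +ℤ b *ℤ g T) else + 0) ≡
                   a *ℤ (if subWordᵇ T S then sign (countTrue S ∸ countTrue T) *ℤ f T else + 0) +ℤ
                   b *ℤ (if subWordᵇ T S then sign (countTrue S ∸ countTrue T) *ℤ g T else + 0)
  termwise T with subWordᵇ T S
  ... | true  = distribute (sign (countTrue S ∸ countTrue T)) a b (f T) (g T)
    where
    distribute : ∀ s a b x y → s *ℤ (a *ℤ x +ℤ b *ℤ y) ≡ a *ℤ (s *ℤ x) +ℤ b *ℤ (s *ℤ y)
    distribute = ℤ-solve-∀
  ... | false = 0≡a*0+b*0 a b

möbius-cong : ∀ m {f g : List Bool → ℤ} S → (∀ T → length T ≡ m → f T ≡ g T) → möbius m f S ≡ möbius m g S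
möbius-cong m S f≗g =
  Σwords-cong m (λ T ∣T∣ →
    cong (λ z → if subWordᵇ T S then sign (countTrue S ∸ countTrue T) *ℤ z else + 0) (f≗g T ∣T∣))

subWord-∷ʳ : ∀ (T S : List Bool) a x → length T ≡ length S → subWordᵇ (T ∷ʳ a) (S ∷ʳ x) ≡ subWordᵇ T S ∧ (not a ∨ x)
subWord-∷ʳ []      []      a x _ = ∧-identityʳ _
subWord-∷ʳ (t ∷ T) (s ∷ S) a x ∣T∣ =
  trans (cong ((not t ∨ s) ∧_) (subWord-∷ʳ T S a x (suc-injective ∣T∣))) (sym (∧-assoc (not t ∨ s) _ _))

countTrue-∷ʳfalse : ∀ w → countTrue (w ∷ʳ false) ≡ countTrue w
countTrue-∷ʳfalse []          = refl
countTrue-∷ʳfalse (true ∷ w)  = cong suc (countTrue-∷ʳfalse w)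
countTrue-∷ʳfalse (false ∷ w) = countTrue-∷ʳfalse w

countTrue-∷ʳtrue : ∀ w → countTrue (w ∷ʳ true) ≡ suc (countTrue w)
countTrue-∷ʳtrue []          = refl
countTrue-∷ʳtrue (true ∷ w)  = cong suc (countTrue-∷ʳtrue w)
countTrue-∷ʳtrue (false ∷ w) = countTrue-∷ʳtrue w

subWord⇒countTrue≤ : ∀ (T S : List Bool) → subWordᵇ T S ≡ true → countTrue T ≤ countTrue S
subWord⇒countTrue≤ []          []          _ = z≤n
subWord⇒countTrue≤ (true ∷ T)  (true ∷ S)  T⊆S = s≤s (subWord⇒countTrue≤ T S T⊆S)
subWord⇒countTrue≤ (false ∷ T) (true ∷ S)  T⊆S = m≤n⇒m≤1+n (subWord⇒countTrue≤ T S T⊆S)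
subWord⇒countTrue≤ (false ∷ T) (false ∷ S) T⊆S = subWord⇒countTrue≤ T S T⊆S

sign-suc : ∀ m → sign (suc m) ≡ -ℤ sign m
sign-suc zero          = refl
sign-suc (suc zero)    = refl
sign-suc (suc (suc m)) = sign-suc m

lastLetterDiff : Bool → (List Bool → ℤ) → List Bool → ℤ
lastLetterDiff false f T = f (T ∷ʳ false)
lastLetterDiff true  f T = f (T ∷ʳ true) -ℤ f (T ∷ʳ false)

möbius-∷ʳ : ∀ m f S x → length S ≡ m → möbius (suc m) f (S ∷ʳ x) ≡ möbius m (lastLetterDiff x f) S
möbius-∷ʳ m f S x ∣S∣ = trans (Σwords-∷ʳ m _) (Σwords-cong m (λ T ∣T∣ → termwise T (trans ∣T∣ (sym ∣S∣)) x))
  where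
  term : List Bool → List Bool → ℤ
  term S′ T = if subWordᵇ T S′ then sign (countTrue S′ ∸ countTrue T) *ℤ f T else + 0
  termwise : ∀ T → length T ≡ length S → ∀ x →
             term (S ∷ʳ x) (T ∷ʳ false) +ℤ term (S ∷ʳ x) (T ∷ʳ true) ≡
             (if subWordᵇ T S then sign (countTrue S ∸ countTrue T) *ℤ lastLetterDiff x f T else + 0)
  termwise T ∣T∣ false
    rewrite subWord-∷ʳ T S false false ∣T∣ | subWord-∷ʳ T S true false ∣T∣
          | ∧-identityʳ (subWordᵇ T S) | ∧-zeroʳ (subWordᵇ T S)
          | countTrue-∷ʳfalse S | countTrue-∷ʳfalse T with subWordᵇ T S
  ... | true  = ℤ.+-identityʳ _
  ... | false = refl
  termwise T ∣T∣ true
    rewrite subWord-∷ʳ T S false true ∣T∣ | subWord-∷ʳ T S true true ∣T∣ | ∧-identityʳ (subWordᵇ T S)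
          | countTrue-∷ʳtrue S | countTrue-∷ʳfalse T | countTrue-∷ʳtrue T with subWordᵇ T S in T⊆S
  ... | false = refl
  ... | true rewrite +-∸-assoc 1 (subWord⇒countTrue≤ T S T⊆S) | sign-suc (countTrue S ∸ countTrue T) =
    alternate (sign (countTrue S ∸ countTrue T)) (f (T ∷ʳ false)) (f (T ∷ʳ true))
    where
    alternate : ∀ s a b → -ℤ s *ℤ a +ℤ s *ℤ b ≡ s *ℤ (b -ℤ a)
    alternate = ℤ-solve-∀

-- The face and flag identities are proved without subtraction in ℕ; this casts them to the
-- coefficients k and −(k − 1) of the theorem.
ℕ-identity⇒ℤ : ∀ {p e q} k → p + k * e ≡ e + k * q → + p ≡ + k *ℤ + q +ℤ -ℤ (+ k -ℤ + 1) *ℤ + e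
ℕ-identity⇒ℤ {p} {e} {q} k eq =
  begin
    + p
  ≡⟨ isolate (+ p) (+ k) (+ e) ⟩
    (+ p +ℤ + k *ℤ + e) -ℤ + k *ℤ + e
  ≡⟨ cong (_-ℤ + k *ℤ + e) (trans (sym (cast p k e)) (trans (cong +_ eq) (cast e k q))) ⟩
    (+ e +ℤ + k *ℤ + q) -ℤ + k *ℤ + e
  ≡⟨ regroup (+ e) (+ k) (+ q) ⟩
    + k *ℤ + q +ℤ -ℤ (+ k -ℤ + 1) *ℤ + e
  ∎
  where
  open ≡-Reasoning
  cast : ∀ a k b → + (a + k * b) ≡ + a +ℤ + k *ℤ + b
  cast a k b = trans (ℤ.pos-+ a (k * b)) (cong (+ a +ℤ_) (ℤ.pos-* k b))
  isolate : ∀ p k e → p ≡ (p +ℤ k *ℤ e) -ℤ k *ℤ e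
  isolate = ℤ-solve-∀
  regroup : ∀ e k q → (e +ℤ k *ℤ q) -ℤ k *ℤ e ≡ k *ℤ q +ℤ -ℤ (k -ℤ + 1) *ℤ e
  regroup = ℤ-solve-∀

module _ {d₀ k n : ℕ} {Fs : List (Subset n)} (st : Stacked (suc d₀) k n Fs) where

  private
    P = polytopeLattice (suc d₀) n Fs
    D = simplexLattice (suc d₀)
    E = simplexLattice d₀
    c = -ℤ (+ k -ℤ + 1)
    αℤ : FinGradedPoset → List Bool → ℤ
    αℤ L T = + α L T

  lastLetterDiff-stacked : ∀ x T → length T ≡ d₀ →
                           lastLetterDiff x (αℤ P) T ≡ + k *ℤ lastLetterDiff x (αℤ D) T +ℤ c *ℤ αℤ E T
  lastLetterDiff-stacked false T ∣T∣ = ℕ-identity⇒ℤ k (α-stacked-∷ʳfalse st T ∣T∣)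
  lastLetterDiff-stacked true  T ∣T∣ =
    trans (cong₂ _-ℤ_ (ℕ-identity⇒ℤ k (α-stacked-∷ʳtrue st T ∣T∣)) (ℕ-identity⇒ℤ k (α-stacked-∷ʳfalse st T ∣T∣)))
          (trans (cong (λ e → (+ k *ℤ αℤ D (T ∷ʳ true) +ℤ c *ℤ e) -ℤ (+ k *ℤ αℤ D (T ∷ʳ false) +ℤ c *ℤ αℤ E T))
                       (ℤ.pos-* 2 (α E T)))
                 (regroup (+ k) c (αℤ D (T ∷ʳ true)) (αℤ D (T ∷ʳ false)) (αℤ E T)))
    where
    regroup : ∀ k c t f e → (k *ℤ t +ℤ c *ℤ (+ 2 *ℤ e)) -ℤ (k *ℤ f +ℤ c *ℤ e) ≡ k *ℤ (t -ℤ f) +ℤ c *ℤ e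
    regroup = ℤ-solve-∀

  β-stacked : ∀ S x → length S ≡ d₀ → β P (S ∷ʳ x) ≡ + k *ℤ β D (S ∷ʳ x) +ℤ c *ℤ β E S
  β-stacked S x ∣S∣ =
    begin
      β P (S ∷ʳ x)
    ≡⟨ möbius-∷ʳ d₀ (αℤ P) S x ∣S∣ ⟩
      möbius d₀ (lastLetterDiff x (αℤ P)) S
    ≡⟨ möbius-cong d₀ S (lastLetterDiff-stacked x) ⟩
      möbius d₀ (λ T → + k *ℤ lastLetterDiff x (αℤ D) T +ℤ c *ℤ αℤ E T) S
    ≡⟨ möbius-linear d₀ (+ k) c (lastLetterDiff x (αℤ D)) (αℤ E) S ⟩
      + k *ℤ möbius d₀ (lastLetterDiff x (αℤ D)) S +ℤ c *ℤ β E S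
    ≡⟨ cong (λ z → + k *ℤ z +ℤ c *ℤ β E S) (sym (möbius-∷ʳ d₀ (αℤ D) S x ∣S∣)) ⟩
      + k *ℤ β D (S ∷ʳ x) +ℤ c *ℤ β E S
    ∎
    where open ≡-Reasoning

  Ψ-stacked : ∀ w → coeff eqAB (Ψ P) w ≡ + k *ℤ coeff eqAB (Ψ D) w +ℤ c *ℤ coeff eqAB (times-a+b (Ψ E)) w
  Ψ-stacked w with initLast w
  ... | []
    rewrite coeff-allWords (suc d₀) (β P) [] | coeff-allWords (suc d₀) (β D) [] | coeff-times-a+b-[] (Ψ E) =
    0≡a*0+b*0 (+ k) c
  ... | S ∷ʳ′ x
    rewrite coeff-allWords (suc d₀) (β P) (S ∷ʳ x) | coeff-allWords (suc d₀) (β D) (S ∷ʳ x)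
          | coeff-times-a+b-∷ʳ (Ψ E) S x | coeff-allWords d₀ (β E) S | length-∷ʳ S x
    with length S ≡ᵇ d₀ in ∣S∣
  ...   | true  = β-stacked S x (≡ᵇ⇒≡ _ _ (true⇒T ∣S∣))
  ...   | false = 0≡a*0+b*0 (+ k) c

lemma7p18 : (d k n : ℕ) (Fs : List (Subset n)) → 1 ≤ d →
    Stacked d k n Fs →
    (Φd Φd₋₁ : Poly CD) →
    IsCDIndex (simplexLattice d) Φd →
    IsCDIndex (simplexLattice (d ∸ 1)) Φd₋₁ →
    IsCDIndex (polytopeLattice d n Fs)
    (((+ k) ⊛ Φd) ⊕ ((-ℤ ((+ k) -ℤ (+ 1))) ⊛ (Φd₋₁ ⊗ cPoly)) )
lemma7p18 (suc d₀) k n Fs _ st Φd Φd₋₁ isΦd isΦd₋₁ w =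
  begin
    coeff eqAB (substCD (((+ k) ⊛ Φd) ⊕ (c ⊛ (Φd₋₁ ⊗ cPoly)))) w
  ≡⟨ coeff-substCD-linear (+ k) Φd c (Φd₋₁ ⊗ cPoly) w ⟩
    + k *ℤ coeff eqAB (substCD Φd) w +ℤ c *ℤ coeff eqAB (substCD (Φd₋₁ ⊗ cPoly)) w
  ≡⟨ cong₂ (λ a b → + k *ℤ a +ℤ c *ℤ b) (isΦd w)
           (trans (cong (λ p → coeff eqAB p w) (substCD-⊗c Φd₋₁))
                  (times-a+b-cong {substCD Φd₋₁} {Ψ (simplexLattice d₀)} isΦd₋₁ w)) ⟩
    + k *ℤ coeff eqAB (Ψ (simplexLattice (suc d₀))) w +ℤ c *ℤ coeff eqAB (times-a+b (Ψ (simplexLattice d₀))) w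
  ≡⟨ sym (Ψ-stacked st w) ⟩
    coeff eqAB (Ψ (polytopeLattice (suc d₀) n Fs)) w
  ∎
  where
  open ≡-Reasoning
  c = -ℤ ((+ k) -ℤ (+ 1))
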